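{- Let $\mathcal K$ be a $d$-dimensional simplicial complex with a gradient vector field $\mathcal V$, and let $\phi_\#:C_\#(\mathcal K,\mathbb Z)\to C_\#(\mathcal K,\mathbb Z)$ be a chain map. Then for every $1\le q\le d$ and every $\beta\in D_q^{(\mathcal V)}$, \[\langle\phi_q(\beta),\beta\rangle_{\widetilde S_q^{(\mathcal V)}}=\langle\phi_{q-1}(\partial_q\beta),\partial_q\beta\rangle_{\widetilde S_{q-1}^{(\mathcal V)}}.\]
   Context: A simplicial complex $\mathcal K$ is a finite nonempty collection of finite sets closed under subsets (so $\emptyset\in\mathcal K$); $\dim\sigma=|\sigma|-1$; $\alpha$ is a facet of $\beta$ if $\alpha\subseteq\beta$ and $\dim\alpha=\dim\beta-1$. A total order on the vertices is fixed; a $q$-simplex with vertices $x_0<\dots<x_q$ is the oriented simplex $[x_0,\dots,x_q]$; $C_q(\mathcal K,\mathbb Z)$ is the free $\mathbb Z$-module on the set $S_q$ of $q$-simplices. For a $q$-simplex $\sigma=[x_0,\dots,x_q]$ and a $(q-1)$-simplex $\tau$ ($\tau=\emptyset$ if $q=0$), $[\sigma,\tau]=(-1)^i$ if $\tau=\sigma\setminus\{x_i\}$, $0$ if $\tau\not\subseteq\sigma$; $\partial_q\sigma=\sum_{\tau}[\sigma,\tau]\tau$ for $q\ge1$, $\partial_0=0$. A chain map is a family of $\mathbb Z$-linear maps $\phi_q:C_q\to C_q$ with $\partial_q\phi_q=\phi_{q-1}\partial_q$. For a $\mathbb Z$-basis $B=\{b_1,\dots,b_m\}$ of $C_q$ and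 $c_1=\sum s_ib_i$, $c_2=\sum s_i'b_i$, $\langle c_1,c_2\rangle_B=\sum_is_is_i'$. A discrete vector field $\mathcal V$ is a set of pairs $(\alpha,\beta)$ of simplices ($\alpha=\emptyset$ allowed) with $\alpha$ a facet of $\beta$, each simplex in at most one pair; write $\mathcal V(\alpha)=\beta$ if $(\alpha,\beta)\in\mathcal V$. A $\mathcal V$-trajectory $P:\beta_0,\alpha_1,\beta_1,\dots,\alpha_r,\beta_r$ ($r\ge0$) consists of alternately $q$- and $(q-1)$-simplices with $(\alpha_i,\beta_i)\in\mathcal V$, $\alpha_i\subsetneq\beta_{i-1}$, $\beta_{i-1}\ne\beta_i$; $\mathbf i(P)=\beta_0$, $\mathbf t(P)=\beta_r$, $w(P)=\prod_{i=1}^r(-[\beta_{i-1},\alpha_i][\beta_i,\alpha_i])$ ($1$ if $r=0$); nontrivial closed if $r>0$, $\beta_r=\beta_0$. A gradient vector field has no nontrivial closed trajectory. A nonempty simplex $\sigma$ is critical if it lies in no pair, or is a $0$-simplex with $(\emptyset,\sigma)\in\mathcal V$. $U_q^{(\mathcal V)}$: $q$-simplices $\alpha$ with $(\alpha,\beta)\in\mathcal V$ for some $\beta$; $D_q^{(\mathcal V)}$: non-critical $q$-simplices $\beta$ with $(\alpha,\beta)\in\mathcal V$ for some $\alpha$. For $\sigma$ critical, $\overrightarrow{\sigma}^{(\mathcal V)}=\sum_{P:\ \mathbf i(P)=\sigma}w(P)\mathbf t(P)$ over all $\mathcal V$-trajectories starting at $\sigma$. $\widetilde S_q^{(\mathcal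 V)}=\{\overrightarrow{\sigma}^{(\mathcal V)}:\sigma$ a critical $q$-simplex$\}\cup\{\partial_{q+1}(\mathcal V(\alpha)):\alpha\in U_q^{(\mathcal V)}\}\cup D_q^{(\mathcal V)}$; this is a $\mathbb Z$-basis of $C_q(\mathcal K,\mathbb Z)$ for each $0\le q\le d$. For $\beta=\mathcal V(\alpha)\in D_q^{(\mathcal V)}$, $\partial_q\beta\in\widetilde S^{(\mathcal V)}_{q-1}$. -}

module Defs where

open import Data.Nat as ℕ using (ℕ; zero; suc; _≤_; _^_)
open import Data.Integer as ℤ using (ℤ; 0ℤ; 1ℤ; -_; _+_; _*_)
open import Data.Bool using (Bool; true; false; if_then_else_; _∧_; _∨_; not)
open import Data.Fin using (Fin; zero; suc)
open import Data.Fin.Subset using (Subset; _⊆_; ∣_∣) renaming (⊥ to ∅)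
open import Data.Fin.Subset.Properties using (_⊆?_)
open import Data.Vec using (Vec; []; _∷_; _[_]≔_)
import Data.Vec as Vec
import Data.Vec.Properties as VecP
import Data.Bool.Properties as BoolP
open import Data.List using (List; []; _∷_; _++_; map; foldr; filterᵇ; concatMap; length; allFin)
open import Data.Bool.ListAction using (any; all)
import Data.List as List
open import Data.Product using (_×_; ∃; _,_)
open import Data.Sum using (_⊎_)
open import Relation.Nullary using (¬_)
open import Relation.Nullary.Decidable using (⌊_⌋)
open import Relation.Binary.PropositionalEquality using (_≡_; _≢_)

sumℤ : List ℤ → ℤ
sumℤ = foldr _+_ 0ℤ

subsets : (n : ℕ) → List (Subset n)
subsets zero    = [] ∷ []
subsets (suc n) = map (true ∷_) (subsets n) ++ map (false ∷_) (subsets n)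

Σs : ∀ {n} → (Subset n → ℤ) → ℤ
Σs {n} f = sumℤ (map f (subsets n))

ΣFin : ∀ {m} → (Fin m → ℤ) → ℤ
ΣFin {m} f = sumℤ (map f (allFin m))

_≟s_ : ∀ {n} (σ τ : Subset n) → Bool
σ ≟s τ = ⌊ VecP.≡-dec BoolP._≟_ σ τ ⌋

-- Simplicial complexes (simplices = finite subsets of Fin n; ∅ included)

record Complex (n : ℕ) : Set where
  field
    mem      : Subset n → Bool
    nonempty : ∃ λ σ → mem σ ≡ true
    closed   : ∀ {σ τ} → τ ⊆ σ → mem σ ≡ true → mem τ ≡ true
open Complex public

Simplex : ∀ {n} → Complex n → ℕ → Subset n → Set
Simplex K q σ = mem K σ ≡ true × ∣ σ ∣ ≡ suc q

simplexᵇ : ∀ {n} → Complex n → ℕ → Subset n → Bool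
simplexᵇ K q σ = mem K σ ∧ ⌊ ∣ σ ∣ ℕ.≟ suc q ⌋

HasDim : ∀ {n} → Complex n → ℕ → Set
HasDim K d = (∃ λ σ → Simplex K d σ) × (∀ σ → mem K σ ≡ true → ∣ σ ∣ ≤ suc d)

negPow : ℕ → ℤ
negPow zero    = 1ℤ
negPow (suc k) = - negPow k

countBelow : ∀ {n} → Subset n → Fin n → ℕ
countBelow (x ∷ σ) zero    = 0
countBelow (x ∷ σ) (suc v) = (if x then 1 else 0) ℕ.+ countBelow σ v

-- [σ,τ] = (-1)^i if τ = σ \ {x_i}  (x_i has exactly i vertices of σ below it), 0 otherwise
incidence : ∀ {n} → Subset n → Subset n → ℤ
incidence σ τ =
  ΣFin (λ v → if Vec.lookup σ v ∧ (τ ≟s (σ [ v ]≔ false))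
              then negPow (countBelow σ v) else 0ℤ)

Chain : ℕ → Set
Chain n = Subset n → ℤ

e : ∀ {n} → Subset n → Chain n
e β τ = if β ≟s τ then 1ℤ else 0ℤ

-- boundary (used for q ≥ 1 only)
∂ : ∀ {n} → Chain n → Chain n
∂ c τ = Σs (λ σ → c σ * incidence σ τ)

IsChainOf : ∀ {n} → Complex n → ℕ → Chain n → Set
IsChainOf K q c = ∀ σ → c σ ≢ 0ℤ → Simplex K q σ

-- a family of linear maps φ_q : C_q → C_q, given by the images φ q σ of
-- the q-simplices σ, extended ℤ-linearly
apply : ∀ {n} → (ℕ → Subset n → Chain n) → ℕ → Chain n → Chain n
apply φ q c τ = Σs (λ σ → c σ * φ q σ τ)

record IsChainMap {n} (K : Complex n) (φ : ℕ → Subset n → Chain n) : Set where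
  field
    into    : ∀ q σ → Simplex K q σ → IsChainOf K q (φ q σ)
    commute : ∀ q c → IsChainOf K (suc q) c →
              ∀ τ → ∂ (apply φ (suc q) c) τ ≡ apply φ q (∂ c) τ

-- Discrete vector fields  (V α β = true  iff  (α, β) ∈ V)

IsFacet : ∀ {n} → Subset n → Subset n → Set
IsFacet α β = α ⊆ β × suc ∣ α ∣ ≡ ∣ β ∣

facetᵇ : ∀ {n} → Subset n → Subset n → Bool
facetᵇ α β = ⌊ α ⊆? β ⌋ ∧ ⌊ suc ∣ α ∣ ℕ.≟ ∣ β ∣ ⌋

record IsDVF {n} (K : Complex n) (V : Subset n → Subset n → Bool) : Set where
  field
    inK    : ∀ α β → V α β ≡ true → mem K α ≡ true × mem K β ≡ true
    facet  : ∀ α β → V α β ≡ true → IsFacet α β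
    unique : ∀ α β α′ β′ → V α β ≡ true → V α′ β′ ≡ true →
             (α ≡ α′ ⊎ α ≡ β′ ⊎ β ≡ α′ ⊎ β ≡ β′) → α ≡ α′ × β ≡ β′

-- V-trajectories  β₀, α₁, β₁, …, α_r, β_r  from β₀ to β_r with r steps
data Traj {n} (V : Subset n → Subset n → Bool) : Subset n → Subset n → ℕ → Set where
  stop : ∀ β → Traj V β β 0
  step : ∀ {β α β′ γ r} → V α β′ ≡ true → IsFacet α β → β ≢ β′ →
         Traj V β′ γ r → Traj V β γ (suc r)

IsGradient : ∀ {n} → (Subset n → Subset n → Bool) → Set
IsGradient V = ∀ β r → ¬ Traj V β β (suc r)

critical : ∀ {n} → Complex n → (Subset n → Subset n → Bool) → Subset n → Bool
critical {n} K V σ =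
  mem K σ ∧ not ⌊ ∣ σ ∣ ℕ.≟ 0 ⌋ ∧
  (all (λ τ → not (V σ τ) ∧ not (V τ σ)) (subsets n)
   ∨ (⌊ ∣ σ ∣ ℕ.≟ 1 ⌋ ∧ V ∅ σ))

-- Σ_{P : i(P) = β, r(P) ≤ N} w(P) t(P)
trajSum : ∀ {n} → (Subset n → Subset n → Bool) → ℕ → Subset n → Chain n
trajSum V zero    β = e β
trajSum V (suc N) β τ =
  e β τ + Σs (λ α → Σs (λ β′ →
    if V α β′ ∧ facetᵇ α β ∧ not (β ≟s β′)
    then (- (incidence β α * incidence β′ α)) * trajSum V N β′ τ
    else 0ℤ))

-- arrow σ = Σ over all V-trajectories P starting at σ of w(P) t(P).
-- (For a gradient field a trajectory has pairwise distinct β's, hence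
--  r < 2^n, so the bound 2^n captures every trajectory.)
arrow : ∀ {n} → (Subset n → Subset n → Bool) → Subset n → Chain n
arrow {n} V σ = trajSum V (2 ^ n) σ

inUᵇ : ∀ {n} → Complex n → (Subset n → Subset n → Bool) → ℕ → Subset n → Bool
inUᵇ {n} K V q α = simplexᵇ K q α ∧ any (λ β → V α β) (subsets n)

inDᵇ : ∀ {n} → Complex n → (Subset n → Subset n → Bool) → ℕ → Subset n → Bool
inDᵇ {n} K V q β = simplexᵇ K q β ∧ not (critical K V β) ∧ any (λ α → V α β) (subsets n)

InD : ∀ {n} → Complex n → (Subset n → Subset n → Bool) → ℕ → Subset n → Set
InD {n} K V q β = Simplex K q β × critical K V β ≡ false × ∃ λ α → V α β ≡ true

basis : ∀ {n} → Complex n → (Subset n → Subset n → Bool) → ℕ → List (Chain n)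
basis {n} K V q =
     map (arrow V) (filterᵇ (λ σ → simplexᵇ K q σ ∧ critical K V σ) (subsets n))
  ++ concatMap (λ α → map (λ β → ∂ (e β)) (filterᵇ (λ β → V α β) (subsets n)))
               (filterᵇ (inUᵇ K V q) (subsets n))
  ++ map e (filterᵇ (inDᵇ K V q) (subsets n))

IsCoords : ∀ {n} (B : List (Chain n)) → Chain n → (Fin (length B) → ℤ) → Set
IsCoords B c s = ∀ τ → c τ ≡ ΣFin (λ i → s i * List.lookup B i τ)

dot : ∀ {m} → (Fin m → ℤ) → (Fin m → ℤ) → ℤ
dot s s′ = ΣFin (λ i → s i * s′ i)

{-# OPTIONS --safe #-}
module Submission where

-- Expand φ_q(β) and φ_{q-1}(∂β) in the bases S̃. Since β and ∂β = ∂(V α₀) are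
-- themselves members of S̃, the two pairings are the coefficient of β in φ_q(β)
-- and the coefficient of ∂(V α₀) in φ_{q-1}(∂β). Evaluate ∂φ_q(β) = φ_{q-1}(∂β)
-- at the simplices α ∈ U_{q-1}: there ∂ kills the arrows of critical simplices
-- (every trajectory sum has boundary [β, α] or 0 at α) and the terms ∂∂(V α′),
-- and no simplex of D lies in U. What remains says that the coefficient vectors
-- b′ (of ∂(V α′) in φ(∂β)) and c ∘ V (c the coefficients of D-simplices in φ(β))
-- have the same image under the matrix ([V α′, α])_{α,α′ ∈ U}. This matrix is
-- invertible because V is gradient: ordering U by the lengths of trajectories
-- makes it triangular with diagonal entries ±1. Hence b′(α₀) = c(V α₀) = c(β).
-- The same triangularity shows that S̃ is linearly independent, so the
-- coordinates of β and ∂β are the unit vectors used above.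

open import Defs
open import Data.Nat using (ℕ; suc; _≤_)
open import Data.Fin using (Fin)
open import Data.Fin.Subset using (Subset)
open import Data.Bool using (Bool)
open import Data.Integer using (ℤ)
open import Data.List using (length)
open import Relation.Binary.PropositionalEquality using (_≡_)

open import Function using (_∘_; id; case_of_)
open import Function.Bundles using (Equivalence)
open import Data.Nat as ℕ using (zero; _^_; s≤s)
import Data.Nat.Properties as ℕₚ
open import Data.Integer as ℤ using (0ℤ; 1ℤ; -_; _+_; _*_; _-_)
import Data.Integer.Properties as ℤₚ
open import Data.Integer.Tactic.RingSolver using (solve-∀)
open import Data.Bool using (true; false; if_then_else_; _∧_; _∨_; not; T; T?)
open import Data.Bool.Properties using (T-≡)
import Data.Bool.Properties as Boolₚ
open import Data.Bool.ListAction using (any; all)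
open import Data.Vec using (_∷_; []; here)
import Data.Vec as Vec
import Data.Vec.Properties as Vecₚ
open import Data.Fin using (zero; suc; toℕ; _<_)
import Data.Fin.Properties as Finₚ
open import Data.Fin.Subset using (_⊆_; ∣_∣) renaming (⊥ to ∅)
open import Data.Fin.Subset.Properties
  using (_⊆?_; out⊆; s⊆s; drop-∷-⊆; p⊆q⇒∣p∣≤∣q∣; ⊆-refl; ⊆-min; anySubset?)
open import Data.List using (List; []; _∷_; _++_; map; filterᵇ; concatMap; allFin; lookup)
open import Data.List.Properties using (map-++; map-∘; map-tabulate; length-++; length-map)
open import Data.List.Membership.Propositional using (_∈_; _∉_; lose)
open import Data.List.Membership.Propositional.Properties
  using (∈-map⁺; ∈-map⁻; ∈-++⁺ˡ; ∈-++⁺ʳ; ∈-++⁻; ∈-filter⁺; ∈-filter⁻)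
open import Data.List.Relation.Unary.Any using (here; there; index; satisfied)
open import Data.List.Relation.Unary.Any.Properties using (lookup-index; any⁺; any⁻)
open import Data.List.Relation.Unary.All using (All; []; _∷_)
import Data.List.Relation.Unary.All as All
open import Data.List.Relation.Unary.All.Properties using (all⁺)
open import Data.List.Relation.Unary.AllPairs using ([]; _∷_)
open import Data.List.Relation.Unary.Unique.Propositional using (Unique)
import Data.List.Relation.Unary.Unique.Propositional.Properties as Unique
open import Data.List.Relation.Binary.Disjoint.Propositional using (Disjoint)
open import Data.Product using (_×_; ∃; _,_; proj₁; proj₂)
import Data.Product.Properties as Productₚ
open import Data.Sum using (_⊎_; inj₁; inj₂)
open import Data.Empty using (⊥; ⊥-elim)
open import Relation.Nullary using (¬_; Dec; yes; no)
open import Relation.Nullary.Decidable using (⌊_⌋; decidable-stable)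
open import Relation.Binary.Definitions using (DecidableEquality)
open import Relation.Binary.PropositionalEquality
  using (_≢_; refl; sym; trans; cong; cong₂; subst; ≢-sym; module ≡-Reasoning)

open Equivalence using (to; from)

module _ {A : Set} where

  sumℤ-cong : ∀ (xs : List A) {f g : A → ℤ} → (∀ x → f x ≡ g x) →
              sumℤ (map f xs) ≡ sumℤ (map g xs)
  sumℤ-cong []       _   = refl
  sumℤ-cong (x ∷ xs) f≗g = cong₂ _+_ (f≗g x) (sumℤ-cong xs f≗g)

  sumℤ-zero : ∀ {xs : List A} {f : A → ℤ} → All (λ x → f x ≡ 0ℤ) xs → sumℤ (map f xs) ≡ 0ℤ
  sumℤ-zero []           = refl
  sumℤ-zero (fx≡0 ∷ f≡0) = cong₂ _+_ fx≡0 (sumℤ-zero f≡0)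

  sumℤ-+ : ∀ (xs : List A) (f g : A → ℤ) →
           sumℤ (map (λ x → f x + g x) xs) ≡ sumℤ (map f xs) + sumℤ (map g xs)
  sumℤ-+ []       f g = refl
  sumℤ-+ (x ∷ xs) f g = trans (cong (f x + g x +_) (sumℤ-+ xs f g))
                              (interchange (f x) (g x) (sumℤ (map f xs)) (sumℤ (map g xs)))
    where
    interchange : ∀ a b c d → a + b + (c + d) ≡ a + c + (b + d)
    interchange = solve-∀

  sumℤ-sub : ∀ (xs : List A) (f g : A → ℤ) →
             sumℤ (map (λ x → f x - g x) xs) ≡ sumℤ (map f xs) - sumℤ (map g xs)
  sumℤ-sub []       f g = refl
  sumℤ-sub (x ∷ xs) f g = trans (cong (f x - g x +_) (sumℤ-sub xs f g))
                                (interchange (f x) (g x) (sumℤ (map f xs)) (sumℤ (map g xs)))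
    where
    interchange : ∀ a b c d → a - b + (c - d) ≡ a + c - (b + d)
    interchange = solve-∀

  sumℤ-*ˡ : ∀ (xs : List A) (c : ℤ) (f : A → ℤ) →
            sumℤ (map (λ x → c * f x) xs) ≡ c * sumℤ (map f xs)
  sumℤ-*ˡ []       c f = sym (ℤₚ.*-zeroʳ c)
  sumℤ-*ˡ (x ∷ xs) c f =
    trans (cong (c * f x +_) (sumℤ-*ˡ xs c f)) (sym (ℤₚ.*-distribˡ-+ c (f x) _))

  sumℤ-*ʳ : ∀ (xs : List A) (c : ℤ) (f : A → ℤ) →
            sumℤ (map (λ x → f x * c) xs) ≡ sumℤ (map f xs) * c
  sumℤ-*ʳ []       c f = refl
  sumℤ-*ʳ (x ∷ xs) c f =
    trans (cong (f x * c +_) (sumℤ-*ʳ xs c f)) (sym (ℤₚ.*-distribʳ-+ c (f x) _))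

  sumℤ-single : ∀ {xs : List A} {f : A → ℤ} {y : A} → Unique xs → y ∈ xs →
                (∀ x → x ≢ y → f x ≡ 0ℤ) → sumℤ (map f xs) ≡ f y
  sumℤ-single {f = f} {y} (y≢xs ∷ _) (here refl) f≡0 =
    trans (cong (f y +_) (sumℤ-zero (All.map (λ y≢x → f≡0 _ (≢-sym y≢x)) y≢xs)))
          (ℤₚ.+-identityʳ (f y))
  sumℤ-single {x ∷ xs} {f} (x≢xs ∷ uniq) (there y∈xs) f≡0 =
    trans (cong (_+ sumℤ (map f xs)) (f≡0 x (All.lookup x≢xs y∈xs)))
          (trans (ℤₚ.+-identityˡ (sumℤ (map f xs))) (sumℤ-single uniq y∈xs f≡0))

sumℤ-++ : ∀ (xs ys : List ℤ) → sumℤ (xs ++ ys) ≡ sumℤ xs + sumℤ ys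
sumℤ-++ []       ys = sym (ℤₚ.+-identityˡ (sumℤ ys))
sumℤ-++ (x ∷ xs) ys = trans (cong (x +_) (sumℤ-++ xs ys)) (sym (ℤₚ.+-assoc x (sumℤ xs) (sumℤ ys)))

sumℤ-swap : ∀ {A B : Set} (xs : List A) (ys : List B) (f : A → B → ℤ) →
            sumℤ (map (λ x → sumℤ (map (f x) ys)) xs) ≡
            sumℤ (map (λ y → sumℤ (map (λ x → f x y) xs)) ys)
sumℤ-swap []       ys f = sym (sumℤ-zero {xs = ys} {f = λ _ → 0ℤ} (All.tabulate (λ _ → refl)))
sumℤ-swap (x ∷ xs) ys f =
  trans (cong (sumℤ (map (f x) ys) +_) (sumℤ-swap xs ys f))
        (sym (sumℤ-+ ys (f x) (λ y → sumℤ (map (λ x′ → f x′ y) xs))))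

ΣFin-suc : ∀ {m} (f : Fin (suc m) → ℤ) → ΣFin f ≡ f zero + ΣFin (f ∘ suc)
ΣFin-suc {m} f = cong (f zero +_) (cong sumℤ
  (trans (map-tabulate suc f) (sym (map-tabulate id (f ∘ suc)))))

∧-true : ∀ {a b : Bool} → (a ∧ b) ≡ true → a ≡ true × b ≡ true
∧-true {true} b≡true = refl , b≡true
∧-true {false} ()

not-true : ∀ {b : Bool} → not b ≡ true → b ≡ false
not-true {false} _ = refl
not-true {true} ()

guarded≡0 : ∀ (b : Bool) {x : ℤ} → (b ≡ true → x ≡ 0ℤ) → (if b then x else 0ℤ) ≡ 0ℤ
guarded≡0 true  x≡0 = x≡0 refl
guarded≡0 false _   = refl

guarded-true : ∀ {b : Bool} {x : ℤ} → b ≡ true → (if b then x else 0ℤ) ≡ x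
guarded-true refl = refl

guarded≢0 : ∀ (b : Bool) {x : ℤ} → (if b then x else 0ℤ) ≢ 0ℤ → b ≡ true
guarded≢0 true  _  = refl
guarded≢0 false ≢0 = ⊥-elim (≢0 refl)

guarded-cong : ∀ (b : Bool) {x y : ℤ} → (b ≡ true → x ≡ y) →
               (if b then x else 0ℤ) ≡ (if b then y else 0ℤ)
guarded-cong true  x≡y = x≡y refl
guarded-cong false _   = refl

*≡0 : ∀ {x y : ℤ} → (x ≢ 0ℤ → y ≢ 0ℤ → ⊥) → x * y ≡ 0ℤ
*≡0 {x} {y} not-both with x ℤ.≟ 0ℤ | y ℤ.≟ 0ℤ
... | yes x≡0 | _       = trans (cong (_* y) x≡0) (ℤₚ.*-zeroˡ y)
... | no _    | yes y≡0 = trans (cong (x *_) y≡0) (ℤₚ.*-zeroʳ x)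
... | no x≢0  | no y≢0  = ⊥-elim (not-both x≢0 y≢0)

≡0-stable : ∀ {x : ℤ} → ¬ x ≢ 0ℤ → x ≡ 0ℤ
≡0-stable {x} = decidable-stable (x ℤ.≟ 0ℤ)

*-cong-≢0 : ∀ a {x y : ℤ} → (a ≢ 0ℤ → x ≡ y) → a * x ≡ a * y
*-cong-≢0 a {x} {y} x≡y with a ℤ.≟ 0ℤ
... | yes refl = trans (ℤₚ.*-zeroˡ x) (sym (ℤₚ.*-zeroˡ y))
... | no a≢0   = cong (a *_) (x≡y a≢0)

*-distribʳ-sub : ∀ a b c → (a - b) * c ≡ a * c - b * c
*-distribʳ-sub = solve-∀

*-zero-middle : ∀ a {x} b → x ≡ 0ℤ → a * (x * b) ≡ 0ℤ
*-zero-middle a b refl = trans (cong (a *_) (ℤₚ.*-zeroˡ b)) (ℤₚ.*-zeroʳ a)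

*-unit-cancel : ∀ {a u : ℤ} → u * u ≡ 1ℤ → a * u ≡ 0ℤ → a ≡ 0ℤ
*-unit-cancel {a} {u} u²≡1 au≡0 = begin
  a           ≡⟨ sym (ℤₚ.*-identityʳ a) ⟩
  a * 1ℤ      ≡⟨ cong (a *_) (sym u²≡1) ⟩
  a * (u * u) ≡⟨ sym (ℤₚ.*-assoc a u u) ⟩
  a * u * u   ≡⟨ cong (_* u) au≡0 ⟩
  0ℤ * u      ≡⟨ ℤₚ.*-zeroˡ u ⟩
  0ℤ          ∎
  where open ≡-Reasoning

∧-intro : ∀ {a b : Bool} → a ≡ true → b ≡ true → (a ∧ b) ≡ true
∧-intro refl refl = refl

∨-true : ∀ {a b : Bool} → (a ∨ b) ≡ true → a ≡ true ⊎ b ≡ true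
∨-true {true}  _ = inj₁ refl
∨-true {false} b = inj₂ b

⌊⌋-sound : ∀ {P : Set} (P? : Dec P) → ⌊ P? ⌋ ≡ true → P
⌊⌋-sound (yes p) _ = p

⌊⌋-complete : ∀ {P : Set} (P? : Dec P) → P → ⌊ P? ⌋ ≡ true
⌊⌋-complete (yes _) _  = refl
⌊⌋-complete (no ¬p) p = ⊥-elim (¬p p)

sub-support : ∀ {A : Set} {P : A → Set} {f g : A → ℤ} →
              (∀ x → f x ≢ 0ℤ → P x) → (∀ x → g x ≢ 0ℤ → P x) → ∀ x → f x - g x ≢ 0ℤ → P x
sub-support {f = f} {g} f-supp g-supp x f-g≢0 with f x ℤ.≟ 0ℤ
... | no fx≢0  = f-supp x fx≢0
... | yes fx≡0 = g-supp x (λ gx≡0 → f-g≢0 (cong₂ _-_ fx≡0 gx≡0))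

module _ {A : Set} where

  ∈-filterᵇ⁻ : ∀ {p : A → Bool} xs {x} → x ∈ filterᵇ p xs → p x ≡ true
  ∈-filterᵇ⁻ {p} xs x∈ = to T-≡ (proj₂ (∈-filter⁻ (T? ∘ p) {xs = xs} x∈))

  ∈-filterᵇ⁺ : ∀ {p : A → Bool} {xs x} → x ∈ xs → p x ≡ true → x ∈ filterᵇ p xs
  ∈-filterᵇ⁺ {p} x∈ px = ∈-filter⁺ (T? ∘ p) x∈ (from T-≡ px)

  any-true⁻ : ∀ {p : A → Bool} xs → any p xs ≡ true → ∃ λ x → p x ≡ true
  any-true⁻ {p} xs h with satisfied (any⁻ p xs (from T-≡ h))
  ... | x , px = x , to T-≡ px

  any-true⁺ : ∀ {p : A → Bool} {xs x} → x ∈ xs → p x ≡ true → any p xs ≡ true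
  any-true⁺ {p} x∈ px = to T-≡ (any⁺ p (lose {P = T ∘ p} x∈ (from T-≡ px)))

  all-true⁻ : ∀ {p : A → Bool} xs {x} → all p xs ≡ true → x ∈ xs → p x ≡ true
  all-true⁻ {p} xs h x∈ = to T-≡ (All.lookup (all⁺ p xs (from T-≡ h)) x∈)

  unique-constant : ∀ {xs : List A} {y} → Unique xs → y ∈ xs → (∀ {x} → x ∈ xs → x ≡ y) →
                    xs ≡ y ∷ []
  unique-constant {x ∷ []}     _                  _ ≡y = cong (_∷ []) (≡y (here refl))
  unique-constant {x ∷ x′ ∷ _} ((x≢x′ ∷ _) ∷ _) _ ≡y =
    ⊥-elim (x≢x′ (trans (≡y (here refl)) (sym (≡y (there (here refl))))))

concatMap-singletons : ∀ {A B : Set} {f : A → List B} {g : A → B} (xs : List A) →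
                       (∀ {x} → x ∈ xs → f x ≡ g x ∷ []) → concatMap f xs ≡ map g xs
concatMap-singletons []       _        = refl
concatMap-singletons (x ∷ xs) f≡[g] =
  cong₂ _++_ (f≡[g] (here refl)) (concatMap-singletons xs (f≡[g] ∘ there))

subsets-complete : ∀ {n} (σ : Subset n) → σ ∈ subsets n
subsets-complete []                  = here refl
subsets-complete {suc n} (true ∷ σ)  = ∈-++⁺ˡ (∈-map⁺ (true ∷_) (subsets-complete σ))
subsets-complete {suc n} (false ∷ σ) =
  ∈-++⁺ʳ (map (true ∷_) (subsets n)) (∈-map⁺ (false ∷_) (subsets-complete σ))

subsets-unique : ∀ n → Unique (subsets n)
subsets-unique zero    = [] ∷ []
subsets-unique (suc n) = Unique.++⁺ (Unique.map⁺ Vecₚ.∷-injectiveʳ (subsets-unique n))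
                                    (Unique.map⁺ Vecₚ.∷-injectiveʳ (subsets-unique n))
                                    heads-differ
  where
  heads-differ : Disjoint (map (true ∷_) (subsets n)) (map (false ∷_) (subsets n))
  heads-differ (∈true , ∈false) with ∈-map⁻ (true ∷_) ∈true | ∈-map⁻ (false ∷_) ∈false
  ... | _ , _ , refl | _ , _ , ()

length-subsets : ∀ n → length (subsets n) ≡ 2 ^ n
length-subsets zero = refl
length-subsets (suc n) = trans (length-++ (map (true ∷_) (subsets n)))
  (cong₂ ℕ._+_ (trans (length-map (true ∷_) (subsets n)) (length-subsets n))
               (trans (length-map (false ∷_) (subsets n))
                      (trans (length-subsets n) (sym (ℕₚ.+-identityʳ (2 ^ n))))))

module _ {n : ℕ} where

  Σs-cong : ∀ {f g : Subset n → ℤ} → (∀ σ → f σ ≡ g σ) → Σs f ≡ Σs g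
  Σs-cong = sumℤ-cong (subsets n)

  Σs-zero : ∀ {f : Subset n → ℤ} → (∀ σ → f σ ≡ 0ℤ) → Σs f ≡ 0ℤ
  Σs-zero f≡0 = sumℤ-zero {xs = subsets n} (All.tabulate (λ {σ} _ → f≡0 σ))

  Σs-single : ∀ {f : Subset n → ℤ} σ → (∀ τ → τ ≢ σ → f τ ≡ 0ℤ) → Σs f ≡ f σ
  Σs-single σ = sumℤ-single (subsets-unique n) (subsets-complete σ)

  Σs-+ : ∀ (f g : Subset n → ℤ) → Σs (λ σ → f σ + g σ) ≡ Σs f + Σs g
  Σs-+ = sumℤ-+ (subsets n)

  Σs-sub : ∀ (f g : Subset n → ℤ) → Σs (λ σ → f σ - g σ) ≡ Σs f - Σs g
  Σs-sub = sumℤ-sub (subsets n)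

  Σs-*ˡ : ∀ (c : ℤ) (f : Subset n → ℤ) → Σs (λ σ → c * f σ) ≡ c * Σs f
  Σs-*ˡ = sumℤ-*ˡ (subsets n)

  Σs-*ʳ : ∀ (c : ℤ) (f : Subset n → ℤ) → Σs (λ σ → f σ * c) ≡ Σs f * c
  Σs-*ʳ = sumℤ-*ʳ (subsets n)

  Σs-swap : ∀ (f : Subset n → Subset n → ℤ) →
            Σs (λ σ → Σs (f σ)) ≡ Σs (λ τ → Σs (λ σ → f σ τ))
  Σs-swap = sumℤ-swap (subsets n) (subsets n)

Σs-split : ∀ {n} (f : Subset (suc n) → ℤ) → Σs f ≡ Σs (f ∘ (true ∷_)) + Σs (f ∘ (false ∷_))
Σs-split {n} f = begin
  sumℤ (map f (map (true ∷_) (subsets n) ++ map (false ∷_) (subsets n)))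
    ≡⟨ cong sumℤ (map-++ f (map (true ∷_) (subsets n)) _) ⟩
  sumℤ (map f (map (true ∷_) (subsets n)) ++ map f (map (false ∷_) (subsets n)))
    ≡⟨ sumℤ-++ (map f (map (true ∷_) (subsets n))) _ ⟩
  sumℤ (map f (map (true ∷_) (subsets n))) + sumℤ (map f (map (false ∷_) (subsets n)))
    ≡⟨ sym (cong₂ _+_ (cong sumℤ (map-∘ (subsets n))) (cong sumℤ (map-∘ (subsets n)))) ⟩
  Σs (f ∘ (true ∷_)) + Σs (f ∘ (false ∷_)) ∎
  where open ≡-Reasoning

module _ {n : ℕ} where

  _≟S_ : DecidableEquality (Subset n)
  _≟S_ = Vecₚ.≡-dec Boolₚ._≟_

  ≟s-refl : ∀ (σ : Subset n) → (σ ≟s σ) ≡ true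
  ≟s-refl σ with Vecₚ.≡-dec Boolₚ._≟_ σ σ
  ... | yes _   = refl
  ... | no σ≢σ = ⊥-elim (σ≢σ refl)

  ≟s-≢ : ∀ {σ τ : Subset n} → σ ≢ τ → (σ ≟s τ) ≡ false
  ≟s-≢ {σ} {τ} σ≢τ with Vecₚ.≡-dec Boolₚ._≟_ σ τ
  ... | yes σ≡τ = ⊥-elim (σ≢τ σ≡τ)
  ... | no _    = refl

  ≟s-false⇒≢ : ∀ {σ τ : Subset n} → (σ ≟s τ) ≡ false → σ ≢ τ
  ≟s-false⇒≢ {σ} σ≟σ≡false refl with () ← trans (sym (≟s-refl σ)) σ≟σ≡false

≟s-∷ : ∀ {n} b (σ τ : Subset n) → ((b ∷ σ) ≟s (b ∷ τ)) ≡ (σ ≟s τ)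
≟s-∷ b σ τ = by-cases (Vecₚ.≡-dec Boolₚ._≟_ σ τ)
  where
  by-cases : Dec (σ ≡ τ) → ((b ∷ σ) ≟s (b ∷ τ)) ≡ (σ ≟s τ)
  by-cases (yes refl) = trans (≟s-refl (b ∷ σ)) (sym (≟s-refl σ))
  by-cases (no σ≢τ)   = trans (≟s-≢ (σ≢τ ∘ Vecₚ.∷-injectiveʳ)) (sym (≟s-≢ σ≢τ))

module _ {n : ℕ} where

  e-diag : ∀ (β : Subset n) → e β β ≡ 1ℤ
  e-diag β rewrite ≟s-refl β = refl

  e-off : ∀ {β τ : Subset n} → β ≢ τ → e β τ ≡ 0ℤ
  e-off β≢τ rewrite ≟s-≢ β≢τ = refl

  e-nonzero : ∀ {β τ : Subset n} → e β τ ≢ 0ℤ → β ≡ τ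
  e-nonzero {β} {τ} eβτ≢0 with Vecₚ.≡-dec Boolₚ._≟_ β τ
  ... | yes β≡τ = β≡τ
  ... | no _    = ⊥-elim (eβτ≢0 refl)

  e-sym : ∀ (β τ : Subset n) → e β τ ≡ e τ β
  e-sym β τ = by-cases (Vecₚ.≡-dec Boolₚ._≟_ β τ)
    where
    by-cases : Dec (β ≡ τ) → e β τ ≡ e τ β
    by-cases (yes refl) = refl
    by-cases (no β≢τ)   = trans (e-off β≢τ) (sym (e-off (≢-sym β≢τ)))

  Σs-eˡ : ∀ (β : Subset n) (f : Subset n → ℤ) → Σs (λ σ → e β σ * f σ) ≡ f β
  Σs-eˡ β f = trans
    (Σs-single β (λ σ σ≢β → trans (cong (_* f σ) (e-off (≢-sym σ≢β))) (ℤₚ.*-zeroˡ (f σ))))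
                    (trans (cong (_* f β) (e-diag β)) (ℤₚ.*-identityˡ (f β)))

  Σs-eʳ : ∀ (β : Subset n) (f : Subset n → ℤ) → Σs (λ σ → f σ * e σ β) ≡ f β
  Σs-eʳ β f = trans (Σs-cong (λ σ → trans (ℤₚ.*-comm (f σ) _) (cong (_* f σ) (e-sym σ β)))) (Σs-eˡ β f)

  ∂-cong : ∀ {c c′ : Chain n} → (∀ σ → c σ ≡ c′ σ) → ∀ τ → ∂ c τ ≡ ∂ c′ τ
  ∂-cong c≗c′ τ = Σs-cong (λ σ → cong (_* incidence σ τ) (c≗c′ σ))

  ∂-e : ∀ (β τ : Subset n) → ∂ (e β) τ ≡ incidence β τ
  ∂-e β τ = Σs-eˡ β (λ σ → incidence σ τ)

  ∂-+ : ∀ (c c′ : Chain n) τ → ∂ (λ σ → c σ + c′ σ) τ ≡ ∂ c τ + ∂ c′ τ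
  ∂-+ c c′ τ = trans (Σs-cong (λ σ → ℤₚ.*-distribʳ-+ (incidence σ τ) (c σ) (c′ σ)))
                     (Σs-+ (λ σ → c σ * incidence σ τ) (λ σ → c′ σ * incidence σ τ))

  ∂-*ˡ : ∀ (a : ℤ) (c : Chain n) τ → ∂ (λ σ → a * c σ) τ ≡ a * ∂ c τ
  ∂-*ˡ a c τ = trans (Σs-cong (λ σ → ℤₚ.*-assoc a (c σ) (incidence σ τ)))
                     (Σs-*ˡ a (λ σ → c σ * incidence σ τ))

  ∂-guarded-*ˡ : ∀ (b : Bool) (a : ℤ) (c : Chain n) τ →
                 ∂ (λ σ → if b then a * c σ else 0ℤ) τ ≡ (if b then a * ∂ c τ else 0ℤ)
  ∂-guarded-*ˡ true  a c τ = ∂-*ˡ a c τ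
  ∂-guarded-*ˡ false a c τ = Σs-zero (λ σ → ℤₚ.*-zeroˡ (incidence σ τ))

  ∂-Σs : ∀ (f : Subset n → Chain n) τ → ∂ (λ σ → Σs (λ x → f x σ)) τ ≡ Σs (λ x → ∂ (f x) τ)
  ∂-Σs f τ = trans (Σs-cong (λ σ → sym (Σs-*ʳ (incidence σ τ) (λ x → f x σ))))
                   (Σs-swap (λ σ x → f x σ * incidence σ τ))

  ∂-Σs-*ˡ : ∀ (a : Subset n → ℤ) (f : Subset n → Chain n) τ →
            ∂ (λ σ → Σs (λ x → a x * f x σ)) τ ≡ Σs (λ x → a x * ∂ (f x) τ)
  ∂-Σs-*ˡ a f τ = trans (∂-Σs (λ x σ → a x * f x σ) τ) (Σs-cong (λ x → ∂-*ˡ (a x) (f x) τ))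

incidenceTerm : ∀ {n} → Subset n → Subset n → Fin n → ℤ
incidenceTerm σ τ v =
  if Vec.lookup σ v ∧ (τ ≟s (σ Vec.[ v ]≔ false)) then negPow (countBelow σ v) else 0ℤ

ΣFin-neg : ∀ {m} (f : Fin m → ℤ) → ΣFin (λ v → - f v) ≡ - ΣFin f
ΣFin-neg {m} f = trans (sumℤ-cong (allFin m) (λ v → sym (ℤₚ.-1*i≡-i (f v))))
                       (trans (sumℤ-*ˡ (allFin m) (- 1ℤ) f) (ℤₚ.-1*i≡-i (ΣFin f)))

ΣFin-zero : ∀ {m} {f : Fin m → ℤ} → (∀ v → f v ≡ 0ℤ) → ΣFin f ≡ 0ℤ
ΣFin-zero {m} f≡0 = sumℤ-zero {xs = allFin m} (All.tabulate (λ {v} _ → f≡0 v))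

if-neg : ∀ (b : Bool) (x : ℤ) → (if b then - x else 0ℤ) ≡ - (if b then x else 0ℤ)
if-neg true  x = refl
if-neg false x = refl

module _ {n : ℕ} (σ τ : Subset n) where

  incidence-tt : incidence (true ∷ σ) (true ∷ τ) ≡ - incidence σ τ
  incidence-tt = begin
    incidence (true ∷ σ) (true ∷ τ)
      ≡⟨ ΣFin-suc (incidenceTerm (true ∷ σ) (true ∷ τ)) ⟩
    0ℤ + ΣFin (incidenceTerm (true ∷ σ) (true ∷ τ) ∘ suc)
      ≡⟨ ℤₚ.+-identityˡ _ ⟩
    ΣFin (incidenceTerm (true ∷ σ) (true ∷ τ) ∘ suc)
      ≡⟨ sumℤ-cong (allFin n) tail ⟩
    ΣFin (λ v → - incidenceTerm σ τ v)
      ≡⟨ ΣFin-neg (incidenceTerm σ τ) ⟩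
    - incidence σ τ ∎
    where
    open ≡-Reasoning
    tail : ∀ v → incidenceTerm (true ∷ σ) (true ∷ τ) (suc v) ≡ - incidenceTerm σ τ v
    tail v = trans (cong (λ b → if Vec.lookup σ v ∧ b then - negPow (countBelow σ v) else 0ℤ)
                         (≟s-∷ true τ (σ Vec.[ v ]≔ false)))
                   (if-neg (Vec.lookup σ v ∧ (τ ≟s (σ Vec.[ v ]≔ false))) _)

  incidence-tf : incidence (true ∷ σ) (false ∷ τ) ≡ e σ τ
  incidence-tf = trans (ΣFin-suc (incidenceTerm (true ∷ σ) (false ∷ τ)))
    (trans (cong₂ _+_ head (ΣFin-zero tail)) (trans (ℤₚ.+-identityʳ _) (e-sym τ σ)))
    where
    head : incidenceTerm (true ∷ σ) (false ∷ τ) zero ≡ e τ σ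
    head = cong (λ b → if b then 1ℤ else 0ℤ) (≟s-∷ false τ σ)
    tail : ∀ v → incidenceTerm (true ∷ σ) (false ∷ τ) (suc v) ≡ 0ℤ
    tail v = cong (λ b → if b then - negPow (countBelow σ v) else 0ℤ)
                  (Boolₚ.∧-zeroʳ (Vec.lookup σ v))

  incidence-ft : incidence (false ∷ σ) (true ∷ τ) ≡ 0ℤ
  incidence-ft = trans (ΣFin-suc (incidenceTerm (false ∷ σ) (true ∷ τ)))
                       (trans (ℤₚ.+-identityˡ _) (ΣFin-zero tail))
    where
    tail : ∀ v → incidenceTerm (false ∷ σ) (true ∷ τ) (suc v) ≡ 0ℤ
    tail v = cong (λ b → if b then negPow (countBelow σ v) else 0ℤ)
                  (Boolₚ.∧-zeroʳ (Vec.lookup σ v))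

  incidence-ff : incidence (false ∷ σ) (false ∷ τ) ≡ incidence σ τ
  incidence-ff = trans (ΣFin-suc (incidenceTerm (false ∷ σ) (false ∷ τ)))
                       (trans (ℤₚ.+-identityˡ _) (sumℤ-cong (allFin n) tail))
    where
    tail : ∀ v → incidenceTerm (false ∷ σ) (false ∷ τ) (suc v) ≡ incidenceTerm σ τ v
    tail v = cong (λ b → if Vec.lookup σ v ∧ b then negPow (countBelow σ v) else 0ℤ)
                  (≟s-∷ false τ (σ Vec.[ v ]≔ false))

neg*neg : ∀ a b → - a * - b ≡ a * b
neg*neg = solve-∀

⊆∧∣≡∣⇒≡ : ∀ {n} {τ σ : Subset n} → τ ⊆ σ → ∣ τ ∣ ≡ ∣ σ ∣ → τ ≡ σ
⊆∧∣≡∣⇒≡ {τ = []}      {[]}      _   _    = refl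
⊆∧∣≡∣⇒≡ {τ = true ∷ τ}  {true ∷ σ}  τ⊆σ size =
  cong (true ∷_) (⊆∧∣≡∣⇒≡ (drop-∷-⊆ τ⊆σ) (ℕₚ.suc-injective size))
⊆∧∣≡∣⇒≡ {τ = false ∷ τ} {false ∷ σ} τ⊆σ size = cong (false ∷_) (⊆∧∣≡∣⇒≡ (drop-∷-⊆ τ⊆σ) size)
⊆∧∣≡∣⇒≡ {τ = true ∷ τ}  {false ∷ σ} τ⊆σ _ with τ⊆σ here
... | ()
⊆∧∣≡∣⇒≡ {τ = false ∷ τ} {true ∷ σ}  τ⊆σ size =
  ⊥-elim (ℕₚ.<-irrefl refl (subst (ℕ._≤ ∣ σ ∣) size (p⊆q⇒∣p∣≤∣q∣ (drop-∷-⊆ τ⊆σ))))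

incidence≢0⇒facet : ∀ {n} (σ τ : Subset n) → incidence σ τ ≢ 0ℤ → IsFacet τ σ
incidence≢0⇒facet []          []          ≢0 = ⊥-elim (≢0 refl)
incidence≢0⇒facet (true ∷ σ)  (true ∷ τ)  ≢0
  with incidence≢0⇒facet σ τ (≢0 ∘ trans (incidence-tt σ τ) ∘ cong (-_))
... | τ⊆σ , size = s⊆s τ⊆σ , cong suc size
incidence≢0⇒facet (true ∷ σ)  (false ∷ τ) ≢0 with e-nonzero (≢0 ∘ trans (incidence-tf σ τ))
... | refl = out⊆ ⊆-refl , refl
incidence≢0⇒facet (false ∷ σ) (true ∷ τ)  ≢0 = ⊥-elim (≢0 (incidence-ft σ τ))
incidence≢0⇒facet (false ∷ σ) (false ∷ τ) ≢0
  with incidence≢0⇒facet σ τ (≢0 ∘ trans (incidence-ff σ τ))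
... | τ⊆σ , size = out⊆ τ⊆σ , size

incidence²≡1 : ∀ {n} (σ τ : Subset n) → IsFacet τ σ → incidence σ τ * incidence σ τ ≡ 1ℤ
incidence²≡1 []          []          (_ , ())
incidence²≡1 (true ∷ σ)  (true ∷ τ)  (τ⊆σ , size) rewrite incidence-tt σ τ =
  trans (neg*neg (incidence σ τ) (incidence σ τ))
        (incidence²≡1 σ τ (drop-∷-⊆ τ⊆σ , ℕₚ.suc-injective size))
incidence²≡1 (true ∷ σ)  (false ∷ τ) (τ⊆σ , size)
  rewrite incidence-tf σ τ | ⊆∧∣≡∣⇒≡ (drop-∷-⊆ τ⊆σ) (ℕₚ.suc-injective size) | e-diag σ = refl
incidence²≡1 (false ∷ σ) (true ∷ τ)  (τ⊆σ , _) with τ⊆σ here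
... | ()
incidence²≡1 (false ∷ σ) (false ∷ τ) (τ⊆σ , size) rewrite incidence-ff σ τ =
  incidence²≡1 σ τ (drop-∷-⊆ τ⊆σ , size)

∂∂≡0 : ∀ {n} (γ α : Subset n) → Σs (λ τ → incidence γ τ * incidence τ α) ≡ 0ℤ
∂∂≡0 []          []          = refl
∂∂≡0 {suc n} (true ∷ γ)  (true ∷ α)  = trans (Σs-split {n} _) (cong₂ _+_
  (trans (Σs-cong (λ τ → trans (cong₂ _*_ (incidence-tt γ τ) (incidence-tt τ α))
                                (neg*neg (incidence γ τ) (incidence τ α))))
         (∂∂≡0 γ α))
  (Σs-zero (λ τ → trans (cong (incidence (true ∷ γ) (false ∷ τ) *_) (incidence-ft τ α))
                        (ℤₚ.*-zeroʳ (incidence (true ∷ γ) (false ∷ τ))))))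
∂∂≡0 {suc n} (true ∷ γ)  (false ∷ α) = trans (Σs-split {n} _) (trans (cong₂ _+_
  (trans (Σs-cong (λ τ → cong₂ _*_ (incidence-tt γ τ) (incidence-tf τ α)))
         (Σs-eʳ α (λ τ → - incidence γ τ)))
  (trans (Σs-cong (λ τ → cong₂ _*_ (incidence-tf γ τ) (incidence-ff τ α)))
         (Σs-eˡ γ (λ τ → incidence τ α))))
  (ℤₚ.+-inverseˡ (incidence γ α)))
∂∂≡0 {suc n} (false ∷ γ) (true ∷ α)  = trans (Σs-split {n} _) (cong₂ _+_
  (Σs-zero (λ τ → trans (cong (_* incidence (true ∷ τ) (true ∷ α)) (incidence-ft γ τ))
                        (ℤₚ.*-zeroˡ (incidence (true ∷ τ) (true ∷ α)))))
  (Σs-zero (λ τ → trans (cong (incidence (false ∷ γ) (false ∷ τ) *_) (incidence-ft τ α))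
                        (ℤₚ.*-zeroʳ (incidence (false ∷ γ) (false ∷ τ))))))
∂∂≡0 {suc n} (false ∷ γ) (false ∷ α) = trans (Σs-split {n} _) (cong₂ _+_
  (Σs-zero (λ τ → trans (cong (_* incidence (true ∷ τ) (false ∷ α)) (incidence-ft γ τ))
                        (ℤₚ.*-zeroˡ (incidence (true ∷ τ) (false ∷ α)))))
  (trans (Σs-cong (λ τ → cong₂ _*_ (incidence-ff γ τ) (incidence-ff τ α))) (∂∂≡0 γ α)))

∂∂e≡0 : ∀ {n} (γ α : Subset n) → ∂ (∂ (e γ)) α ≡ 0ℤ
∂∂e≡0 γ α = trans (∂-cong (∂-e γ) α) (∂∂≡0 γ α)

facetᵇ-sound : ∀ {n} {α β : Subset n} → facetᵇ α β ≡ true → IsFacet α β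
facetᵇ-sound {α = α} {β} _ with α ⊆? β | suc ∣ α ∣ ℕ.≟ ∣ β ∣
facetᵇ-sound _  | yes α⊆β | yes size = α⊆β , size
facetᵇ-sound () | yes _   | no _
facetᵇ-sound () | no _    | _

facetᵇ-complete : ∀ {n} {α β : Subset n} → IsFacet α β → facetᵇ α β ≡ true
facetᵇ-complete {α = α} {β} (α⊆β , size) with α ⊆? β | suc ∣ α ∣ ℕ.≟ ∣ β ∣
... | yes _   | yes _    = refl
... | yes _   | no size≢ = ⊥-elim (size≢ size)
... | no α⊈β | _        = ⊥-elim (α⊈β α⊆β)

incidence-nonfacet : ∀ {n} (σ τ : Subset n) → facetᵇ τ σ ≡ false → incidence σ τ ≡ 0ℤ
incidence-nonfacet σ τ notFacet with incidence σ τ ℤ.≟ 0ℤ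
... | yes ≡0 = ≡0
... | no ≢0  with () ← trans (sym (facetᵇ-complete (incidence≢0⇒facet σ τ ≢0))) notFacet

module Trajectories {n : ℕ} (V : Subset n → Subset n → Bool) where

  PairedUp PairedDown : Subset n → Set
  PairedUp α   = ∃ λ β → V α β ≡ true
  PairedDown β = ∃ λ α → V α β ≡ true

  pairedDown? : ∀ β → Dec (PairedDown β)
  pairedDown? β = anySubset? (λ α → V α β Boolₚ.≟ true)

  witness : ∀ {P : Subset n → Set} → Dec (∃ P) → Subset n
  witness (yes (σ , _)) = σ
  witness (no _)        = ∅

  witness-sound : ∀ {P : Subset n → Set} (P? : Dec (∃ P)) {σ} → P σ → P (witness P?)
  witness-sound (yes (_ , Pσ′)) _  = Pσ′
  witness-sound (no ¬∃P)        Pσ = ⊥-elim (¬∃P (_ , Pσ))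

  partner : Subset n → Subset n
  partner α = witness (anySubset? (λ β → V α β Boolₚ.≟ true))

  partner-pairs : ∀ {α} → PairedUp α → V α (partner α) ≡ true
  partner-pairs {α} (_ , v) = witness-sound (anySubset? (λ β → V α β Boolₚ.≟ true)) v

  Traj-snoc : ∀ {β γ δ α r} → Traj V β γ r → V α δ ≡ true → IsFacet α γ → γ ≢ δ →
              Traj V β δ (suc r)
  Traj-snoc (stop _)                v α⊂γ γ≢δ = step v α⊂γ γ≢δ (stop _)
  Traj-snoc (step v′ α′⊂β β≢β′ t) v α⊂γ γ≢δ = step v′ α′⊂β β≢β′ (Traj-snoc t v α⊂γ γ≢δ)

  vertices : ∀ {β γ r} → Traj V β γ r → Vec.Vec (Subset n) (suc r)
  vertices (stop β)               = β ∷ []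
  vertices (step {β = β} _ _ _ t) = β ∷ vertices t

  prefix : ∀ {β γ r} (t : Traj V β γ r) (k : Fin (suc r)) →
           Traj V β (Vec.lookup (vertices t) k) (toℕ k)
  prefix (stop β)              zero    = stop β
  prefix (step _ _ _ _)        zero    = stop _
  prefix (step v α⊂β β≢β′ t) (suc k) = step v α⊂β β≢β′ (prefix t k)

  module _ (grad : IsGradient V) where

    vertices-distinct : ∀ {β γ r} (t : Traj V β γ r) {i j} → i < j →
                        Vec.lookup (vertices t) i ≢ Vec.lookup (vertices t) j
    vertices-distinct t@(step _ _ _ _) {zero} {suc j} _ same =
      grad _ (toℕ j) (subst (λ δ → Traj V _ δ (suc (toℕ j))) (sym same) (prefix t (suc j)))
    vertices-distinct (step _ _ _ t) {suc i} {suc j} (s≤s i<j) same =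
      vertices-distinct t i<j same

    -- pigeonhole: a trajectory of length 2ⁿ visits 2ⁿ + 1 simplices
    ¬Traj-2^n : ∀ {β γ} → ¬ Traj V β γ (2 ^ n)
    ¬Traj-2^n t
      with Finₚ.pigeonhole (s≤s (ℕₚ.≤-reflexive (length-subsets n)))
                           (index ∘ subsets-complete ∘ Vec.lookup (vertices t))
    ... | i , j , i<j , same-index = vertices-distinct t i<j
      (trans (lookup-index (subsets-complete (Vec.lookup (vertices t) i)))
        (trans (cong (lookup (subsets n)) same-index)
               (sym (lookup-index (subsets-complete (Vec.lookup (vertices t) j))))))

  stepGuard : Subset n → Subset n → Subset n → Bool
  stepGuard β α β′ = V α β′ ∧ facetᵇ α β ∧ not (β ≟s β′)

  stepWeight : Subset n → Subset n → Subset n → ℤ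
  stepWeight β α β′ = - (incidence β α * incidence β′ α)

  stepGuard-sound : ∀ {β α β′} → stepGuard β α β′ ≡ true →
                    V α β′ ≡ true × IsFacet α β × β ≢ β′
  stepGuard-sound guard with ∧-true guard
  ... | paired , rest with ∧-true rest
  ... | isFacet , distinct = paired , facetᵇ-sound isFacet , ≟s-false⇒≢ (not-true distinct)

  trajSum-unpaired : ∀ N β {τ} → ¬ PairedDown τ → trajSum V N β τ ≡ e β τ
  trajSum-unpaired zero    β τ-unpaired = refl
  trajSum-unpaired (suc N) β {τ} τ-unpaired =
    trans (cong (e β τ +_) (Σs-zero λ α → Σs-zero λ β′ →
                              guarded≡0 (stepGuard β α β′) (step≡0 α β′)))
          (ℤₚ.+-identityʳ (e β τ))
    where
    step≡0 : ∀ α β′ → stepGuard β α β′ ≡ true → stepWeight β α β′ * trajSum V N β′ τ ≡ 0ℤ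
    step≡0 α β′ guard = trans
      (cong (stepWeight β α β′ *_)
            (trans (trajSum-unpaired N β′ τ-unpaired)
                   (e-off λ { refl → τ-unpaired (α , proj₁ (stepGuard-sound guard)) })))
      (ℤₚ.*-zeroʳ (stepWeight β α β′))

  ∂-trajSum-suc : ∀ N β τ → ∂ (trajSum V (suc N) β) τ ≡
    incidence β τ + Σs (λ α → Σs (λ β′ →
      if stepGuard β α β′ then stepWeight β α β′ * ∂ (trajSum V N β′) τ else 0ℤ))
  ∂-trajSum-suc N β τ = trans (∂-+ (e β) _ τ) (cong₂ _+_ (∂-e β τ)
    (trans (∂-Σs _ τ) (Σs-cong λ α → trans (∂-Σs _ τ) (Σs-cong λ β′ →
      ∂-guarded-*ˡ (stepGuard β α β′) (stepWeight β α β′) (trajSum V N β′) τ))))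

-- The members of S̃_q are labelled by a part and a simplex: the arrow of a
-- critical simplex (C), the boundary ∂(V α) of some α ∈ U_q (U), or a
-- simplex of D_q (D).
data Part : Set where
  C U D : Part

_≟P_ : DecidableEquality Part
C ≟P C = yes refl
U ≟P U = yes refl
D ≟P D = yes refl
C ≟P U = no λ ()
C ≟P D = no λ ()
U ≟P C = no λ ()
U ≟P D = no λ ()
D ≟P C = no λ ()
D ≟P U = no λ ()

Key : ℕ → Set
Key n = Part × Subset n

module _ {n : ℕ} where

  _≟K_ : DecidableEquality (Key n)
  _≟K_ = Productₚ.≡-dec _≟P_ _≟S_

  ΣK : (Key n → ℤ) → ℤ
  ΣK f = Σs (λ σ → f (C , σ)) + (Σs (λ σ → f (U , σ)) + Σs (λ σ → f (D , σ)))

  ΣK-cong : ∀ {f g : Key n → ℤ} → (∀ k → f k ≡ g k) → ΣK f ≡ ΣK g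
  ΣK-cong f≗g = cong₂ _+_ (Σs-cong (λ σ → f≗g (C , σ)))
                          (cong₂ _+_ (Σs-cong (λ σ → f≗g (U , σ))) (Σs-cong (λ σ → f≗g (D , σ))))

  ΣK-zero : ∀ {f : Key n → ℤ} → (∀ k → f k ≡ 0ℤ) → ΣK f ≡ 0ℤ
  ΣK-zero f≡0 = cong₂ _+_ (Σs-zero (λ σ → f≡0 (C , σ)))
                          (cong₂ _+_ (Σs-zero (λ σ → f≡0 (U , σ))) (Σs-zero (λ σ → f≡0 (D , σ))))

  ΣK-+ : ∀ (f g : Key n → ℤ) → ΣK (λ k → f k + g k) ≡ ΣK f + ΣK g
  ΣK-+ f g = trans
    (cong₂ _+_ (Σs-+ (f ∘ (C ,_)) (g ∘ (C ,_)))
               (cong₂ _+_ (Σs-+ (f ∘ (U ,_)) (g ∘ (U ,_))) (Σs-+ (f ∘ (D ,_)) (g ∘ (D ,_)))))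
    (regroup (Σs (f ∘ (C ,_))) (Σs (g ∘ (C ,_))) (Σs (f ∘ (U ,_))) (Σs (g ∘ (U ,_)))
             (Σs (f ∘ (D ,_))) (Σs (g ∘ (D ,_))))
    where
    regroup : ∀ a a′ b b′ c c′ → a + a′ + (b + b′ + (c + c′)) ≡ a + (b + c) + (a′ + (b′ + c′))
    regroup = solve-∀

  ΣK-sub : ∀ (f g : Key n → ℤ) → ΣK (λ k → f k - g k) ≡ ΣK f - ΣK g
  ΣK-sub f g = trans
    (cong₂ _+_ (Σs-sub (f ∘ (C ,_)) (g ∘ (C ,_)))
               (cong₂ _+_ (Σs-sub (f ∘ (U ,_)) (g ∘ (U ,_))) (Σs-sub (f ∘ (D ,_)) (g ∘ (D ,_)))))
    (regroup (Σs (f ∘ (C ,_))) (Σs (g ∘ (C ,_))) (Σs (f ∘ (U ,_))) (Σs (g ∘ (U ,_)))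
             (Σs (f ∘ (D ,_))) (Σs (g ∘ (D ,_))))
    where
    regroup : ∀ a a′ b b′ c c′ → a - a′ + (b - b′ + (c - c′)) ≡ a + (b + c) - (a′ + (b′ + c′))
    regroup = solve-∀

  ΣK-single : ∀ {f : Key n → ℤ} k → (∀ k′ → k′ ≢ k → f k′ ≡ 0ℤ) → ΣK f ≡ f k
  ΣK-single (C , σ) f≡0 = trans
    (cong₂ _+_ (Σs-single σ (λ τ τ≢σ → f≡0 (C , τ) (τ≢σ ∘ cong proj₂)))
               (cong₂ _+_ (Σs-zero (λ τ → f≡0 (U , τ) λ ())) (Σs-zero (λ τ → f≡0 (D , τ) λ ()))))
    (ℤₚ.+-identityʳ _)
  ΣK-single (U , σ) f≡0 = trans
    (cong₂ _+_ (Σs-zero (λ τ → f≡0 (C , τ) λ ()))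
               (cong₂ _+_ (Σs-single σ (λ τ τ≢σ → f≡0 (U , τ) (τ≢σ ∘ cong proj₂)))
                          (Σs-zero (λ τ → f≡0 (D , τ) λ ()))))
    (trans (ℤₚ.+-identityˡ _) (ℤₚ.+-identityʳ _))
  ΣK-single (D , σ) f≡0 = trans
    (cong₂ _+_ (Σs-zero (λ τ → f≡0 (C , τ) λ ()))
               (cong₂ _+_ (Σs-zero (λ τ → f≡0 (U , τ) λ ()))
                          (Σs-single σ (λ τ τ≢σ → f≡0 (D , τ) (τ≢σ ∘ cong proj₂)))))
    (trans (ℤₚ.+-identityˡ _) (ℤₚ.+-identityˡ _))

  δ : Key n → Key n → ℤ
  δ k k′ = if ⌊ k ≟K k′ ⌋ then 1ℤ else 0ℤ

  δ-diag : ∀ k → δ k k ≡ 1ℤ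
  δ-diag k with k ≟K k
  ... | yes _   = refl
  ... | no k≢k = ⊥-elim (k≢k refl)

  δ-off : ∀ {k k′} → k ≢ k′ → δ k k′ ≡ 0ℤ
  δ-off {k} {k′} k≢k′ with k ≟K k′
  ... | yes k≡k′ = ⊥-elim (k≢k′ k≡k′)
  ... | no _     = refl

  δ-nonzero : ∀ {k k′} → δ k k′ ≢ 0ℤ → k ≡ k′
  δ-nonzero {k} {k′} δ≢0 with k ≟K k′
  ... | yes k≡k′ = k≡k′
  ... | no _     = ⊥-elim (δ≢0 refl)

  ΣK-δʳ : ∀ (f : Key n → ℤ) k → ΣK (λ k′ → f k′ * δ k k′) ≡ f k
  ΣK-δʳ f k = trans
    (ΣK-single k (λ k′ k′≢k → trans (cong (f k′ *_) (δ-off (≢-sym k′≢k))) (ℤₚ.*-zeroʳ (f k′))))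
                    (trans (cong (f k *_) (δ-diag k)) (ℤₚ.*-identityʳ (f k)))

  ΣK-δˡ : ∀ (f : Key n → ℤ) k → ΣK (λ k′ → δ k k′ * f k′) ≡ f k
  ΣK-δˡ f k = trans (ΣK-cong (λ k′ → ℤₚ.*-comm (δ k k′) (f k′))) (ΣK-δʳ f k)

  labelled-unique : ∀ {p : Part} {L : List (Subset n)} → Unique L → Unique (map (p ,_) L)
  labelled-unique = Unique.map⁺ (cong proj₂)

  labels-disjoint : ∀ {p p′ : Part} {L L′ : List (Subset n)} → p ≢ p′ →
                    Disjoint (map (p ,_) L) (map (p′ ,_) L′)
  labels-disjoint p≢p′ (k∈ , k∈′) with ∈-map⁻ _ k∈ | ∈-map⁻ _ k∈′
  ... | _ , _ , refl | _ , _ , same = p≢p′ (cong proj₁ same)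

module Coordinates {n : ℕ} (F : Key n → Chain n) where

  open import Data.List.Membership.DecPropositional (_≟K_ {n}) using (_∈?_)

  coef : (M : List (Key n)) → (Fin (length (map F M)) → ℤ) → Key n → ℤ
  coef []      x k = 0ℤ
  coef (m ∷ M) x k = δ m k * x zero + coef M (x ∘ suc) k

  coef-∉ : ∀ M x {k} → k ∉ M → coef M x k ≡ 0ℤ
  coef-∉ []      x k∉ = refl
  coef-∉ (m ∷ M) x k∉ = cong₂ _+_
    (trans (cong (_* x zero) (δ-off (k∉ ∘ here ∘ sym))) (ℤₚ.*-zeroˡ (x zero)))
    (coef-∉ M (x ∘ suc) (k∉ ∘ there))

  coef-support : ∀ M x k → coef M x k ≢ 0ℤ → k ∈ M
  coef-support M x k coef≢0 with k ∈? M
  ... | yes k∈M = k∈M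
  ... | no k∉M  = ⊥-elim (coef≢0 (coef-∉ M x k∉M))

  lookup-combination : ∀ M x τ →
    ΣFin (λ i → x i * lookup (map F M) i τ) ≡ ΣK (λ k → coef M x k * F k τ)
  lookup-combination []      x τ = sym (ΣK-zero (λ k → ℤₚ.*-zeroˡ (F k τ)))
  lookup-combination (m ∷ M) x τ = begin
    ΣFin (λ i → x i * lookup (map F (m ∷ M)) i τ)
      ≡⟨ ΣFin-suc (λ i → x i * lookup (map F (m ∷ M)) i τ) ⟩
    x zero * F m τ + ΣFin (λ i → x (suc i) * lookup (map F M) i τ)
      ≡⟨ cong₂ _+_ head (lookup-combination M (x ∘ suc) τ) ⟩
    ΣK (λ k → δ m k * (x zero * F k τ)) + ΣK (λ k → coef M (x ∘ suc) k * F k τ)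
      ≡⟨ sym (ΣK-+ (λ k → δ m k * (x zero * F k τ)) (λ k → coef M (x ∘ suc) k * F k τ)) ⟩
    ΣK (λ k → δ m k * (x zero * F k τ) + coef M (x ∘ suc) k * F k τ)
      ≡⟨ ΣK-cong (λ k → trans (cong (_+ coef M (x ∘ suc) k * F k τ)
                                    (sym (ℤₚ.*-assoc (δ m k) (x zero) (F k τ))))
                              (sym (ℤₚ.*-distribʳ-+ (F k τ) (δ m k * x zero) (coef M (x ∘ suc) k)))) ⟩
    ΣK (λ k → coef (m ∷ M) x k * F k τ) ∎
    where
    open ≡-Reasoning
    head : x zero * F m τ ≡ ΣK (λ k → δ m k * (x zero * F k τ))
    head = sym (ΣK-δˡ (λ k → x zero * F k τ) m)

  dot-coef : ∀ M → Unique M → ∀ x y → dot x y ≡ ΣK (λ k → coef M x k * coef M y k)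
  dot-coef []      _          x y = sym (ΣK-zero {f = λ k → coef [] x k * coef [] y k} (λ _ → refl))
  dot-coef (m ∷ M) uniq@(_ ∷ uniq′) x y = begin
    dot x y
      ≡⟨ ΣFin-suc (λ i → x i * y i) ⟩
    x zero * y zero + dot (x ∘ suc) (y ∘ suc)
      ≡⟨ cong₂ _+_ (sym (ΣK-δˡ (λ _ → x zero * y zero) m)) (dot-coef M uniq′ (x ∘ suc) (y ∘ suc)) ⟩
    ΣK (λ k → δ m k * (x zero * y zero)) + ΣK (λ k → coef M (x ∘ suc) k * coef M (y ∘ suc) k)
      ≡⟨ sym (ΣK-+ (λ k → δ m k * (x zero * y zero))
                   (λ k → coef M (x ∘ suc) k * coef M (y ∘ suc) k)) ⟩
    ΣK (λ k → δ m k * (x zero * y zero) + coef M (x ∘ suc) k * coef M (y ∘ suc) k)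
      ≡⟨ ΣK-cong (λ k → expand k (m ≟K k)) ⟩
    ΣK (λ k → coef (m ∷ M) x k * coef (m ∷ M) y k) ∎
    where
    open ≡-Reasoning
    m∉M : m ∉ M
    m∉M = Unique.Unique[x∷xs]⇒x∉xs uniq
    -- at k = m the tails vanish (m occurs once), elsewhere the heads do
    expand : ∀ k → Dec (m ≡ k) →
      δ m k * (x zero * y zero) + coef M (x ∘ suc) k * coef M (y ∘ suc) k
      ≡ (δ m k * x zero + coef M (x ∘ suc) k) * (δ m k * y zero + coef M (y ∘ suc) k)
    expand k (yes refl)
      rewrite δ-diag m | coef-∉ M (x ∘ suc) m∉M | coef-∉ M (y ∘ suc) m∉M = solve (x zero) (y zero)
      where
      solve : ∀ a b → 1ℤ * (a * b) + 0ℤ * 0ℤ ≡ (1ℤ * a + 0ℤ) * (1ℤ * b + 0ℤ)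
      solve = solve-∀
    expand k (no m≢k) rewrite δ-off m≢k =
      solve (x zero) (y zero) (coef M (x ∘ suc) k) (coef M (y ∘ suc) k)
      where
      solve : ∀ a b c d → 0ℤ * (a * b) + c * d ≡ (0ℤ * a + c) * (0ℤ * b + d)
      solve = solve-∀

module VectorField {n : ℕ} {K : Complex n} {V : Subset n → Subset n → Bool}
                   (dvf : IsDVF K V) where

  open IsDVF dvf
  open Trajectories V public

  V-functional : ∀ {α β β′} → V α β ≡ true → V α β′ ≡ true → β ≡ β′
  V-functional {α} {β} {β′} v v′ = proj₂ (unique α β α β′ v v′ (inj₁ refl))

  V-injective : ∀ {α α′ β} → V α β ≡ true → V α′ β ≡ true → α ≡ α′
  V-injective {α} {α′} {β} v v′ = proj₁ (unique α β α′ β v v′ (inj₂ (inj₂ (inj₂ refl))))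

  pairedUp⇒¬pairedDown : ∀ {α} → PairedUp α → ¬ PairedDown α
  pairedUp⇒¬pairedDown {α} (β , v) (γ , v′) with unique α β γ α v v′ (inj₂ (inj₁ refl))
  ... | refl , refl = ℕₚ.1+n≢n (proj₂ (facet α α v))

  partner-spec : ∀ {α β} → V α β ≡ true → partner α ≡ β
  partner-spec v = V-functional (partner-pairs (_ , v)) v

  partner-injective : ∀ {α α′} → PairedUp α → PairedUp α′ → partner α ≡ partner α′ → α ≡ α′
  partner-injective {α′ = α′} up up′ same =
    V-injective (partner-pairs up) (subst (λ β → V α′ β ≡ true) (sym same) (partner-pairs up′))

  partner-facet : ∀ {α} → PairedUp α → IsFacet α (partner α)
  partner-facet up = facet _ _ (partner-pairs up)

  -- the only facet of a vertex is ∅, whose partner is the vertex itself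
  trajSum-from-∅ : ∀ {σ} → V ∅ σ ≡ true → ∀ N τ → trajSum V N σ τ ≡ e σ τ
  trajSum-from-∅ v∅ zero    τ = refl
  trajSum-from-∅ {σ} v∅ (suc N) τ =
    trans (cong (e σ τ +_) (Σs-zero λ α → Σs-zero λ β′ →
                              guarded≡0 (stepGuard σ α β′) (⊥-elim ∘ no-step)))
          (ℤₚ.+-identityʳ (e σ τ))
    where
    no-step : ∀ {α β′} → stepGuard σ α β′ ≡ true → ⊥
    no-step {α} {β′} guard with stepGuard-sound guard
    ... | v , (_ , size) , σ≢β′
      with ⊆∧∣≡∣⇒≡ (⊆-min α) (ℕₚ.suc-injective (trans (proj₂ (facet ∅ σ v∅)) (sym size)))
    ... | refl = σ≢β′ (V-functional v∅ v)

  sift-steps : ∀ {α γ} → V α γ ≡ true → ∀ β (r : Subset n → ℤ) →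
    Σs (λ α′ → Σs (λ β′ → if stepGuard β α′ β′ then stepWeight β α′ β′ * (e β′ γ * r β′) else 0ℤ))
    ≡ (if stepGuard β α γ then stepWeight β α γ * (e γ γ * r γ) else 0ℤ)
  sift-steps {α} {γ} v β r =
    trans (Σs-single α (λ α′ α′≢α → Σs-zero (λ β′ → off α′ β′ (α′≢α ∘ proj₁))))
          (Σs-single γ (λ β′ β′≢γ → off α β′ (β′≢γ ∘ proj₂)))
    where
    off : ∀ α′ β′ → ¬ (α′ ≡ α × β′ ≡ γ) →
          (if stepGuard β α′ β′ then stepWeight β α′ β′ * (e β′ γ * r β′) else 0ℤ) ≡ 0ℤ
    off α′ β′ not-αγ = guarded≡0 (stepGuard β α′ β′) λ guard →
      *-zero-middle (stepWeight β α′ β′) (r β′)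
        (e-off {β = β′} {τ = γ} λ { refl →
          not-αγ (V-injective (proj₁ (stepGuard-sound guard)) v , refl) })

  lastStep : Subset n → Subset n → Subset n → ℤ
  lastStep β α γ = if stepGuard β α γ then stepWeight β α γ * (e γ γ * incidence γ α) else 0ℤ

  last-step-cancels-≢ : ∀ {α γ} → V α γ ≡ true → ∀ {β} → β ≢ γ →
    incidence β α + lastStep β α γ ≡ 0ℤ
  last-step-cancels-≢ {α} {γ} v {β} β≢γ =
    trans (cong (λ b → incidence β α + (if b then stepWeight β α γ * (e γ γ * incidence γ α) else 0ℤ))
                guard≡facet)
          (by-facet (facetᵇ α β) refl)
    where
    guard≡facet : stepGuard β α γ ≡ facetᵇ α β
    guard≡facet rewrite v | ≟s-≢ β≢γ = Boolₚ.∧-identityʳ (facetᵇ α β)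
    a-a·b²≡0 : ∀ a b → b * b ≡ 1ℤ → a + - (a * b) * (1ℤ * b) ≡ 0ℤ
    a-a·b²≡0 a b b²≡1 = begin
      a + - (a * b) * (1ℤ * b) ≡⟨ solve a b ⟩
      a - a * (b * b)          ≡⟨ cong (λ x → a - a * x) b²≡1 ⟩
      a - a * 1ℤ               ≡⟨ cong (λ x → a - x) (ℤₚ.*-identityʳ a) ⟩
      a - a                    ≡⟨ ℤₚ.+-inverseʳ a ⟩
      0ℤ                       ∎
      where
      open ≡-Reasoning
      solve : ∀ a b → a + - (a * b) * (1ℤ * b) ≡ a - a * (b * b)
      solve = solve-∀
    by-facet : ∀ b → facetᵇ α β ≡ b →
      incidence β α + (if b then stepWeight β α γ * (e γ γ * incidence γ α) else 0ℤ) ≡ 0ℤ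
    by-facet true  _        =
      trans (cong (λ x → incidence β α + stepWeight β α γ * (x * incidence γ α)) (e-diag γ))
            (a-a·b²≡0 (incidence β α) (incidence γ α) (incidence²≡1 γ α (facet α γ v)))
    by-facet false notFacet =
      trans (ℤₚ.+-identityʳ (incidence β α)) (incidence-nonfacet β α notFacet)

  last-step-cancels : ∀ {α γ} → V α γ ≡ true → ∀ β →
    incidence β α + lastStep β α γ ≡ e β γ * incidence β α
  last-step-cancels {α} {γ} v β = by-cases (β ≟S γ)
    where
    by-cases : Dec (β ≡ γ) →
      incidence β α + lastStep β α γ ≡ e β γ * incidence β α
    by-cases (no β≢γ)   = trans (last-step-cancels-≢ v β≢γ)
      (sym (trans (cong (_* incidence β α) (e-off β≢γ)) (ℤₚ.*-zeroˡ (incidence β α))))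
    by-cases (yes refl) = trans
      (cong (incidence β α +_) (guarded≡0 (stepGuard β α β) λ guard →
                                 ⊥-elim (proj₂ (proj₂ (stepGuard-sound guard)) refl)))
      (trans (ℤₚ.+-identityʳ (incidence β α))
             (sym (trans (cong (_* incidence β α) (e-diag β)) (ℤₚ.*-identityˡ (incidence β α)))))

  -- Only the steps into γ = V α survive at α, and the one from β has weight
  -- −[β, α][γ, α]; since [γ, α]² = 1 it cancels [β, α] unless β = γ.
  ∂trajSum-pairedUp : ∀ {α γ} → V α γ ≡ true → ∀ N β → (∀ δ → ¬ Traj V β δ N) →
                      ∂ (trajSum V N β) α ≡ e β γ * incidence β α
  ∂trajSum-pairedUp v zero β noTraj = ⊥-elim (noTraj β (stop β))
  ∂trajSum-pairedUp {α} {γ} v (suc N) β noTraj = begin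
    ∂ (trajSum V (suc N) β) α
      ≡⟨ ∂-trajSum-suc N β α ⟩
    incidence β α + Σs (λ α′ → Σs (λ β′ →
      if stepGuard β α′ β′ then stepWeight β α′ β′ * ∂ (trajSum V N β′) α else 0ℤ))
      ≡⟨ cong (incidence β α +_) (Σs-cong λ α′ → Σs-cong λ β′ →
           guarded-cong (stepGuard β α′ β′) (cong (stepWeight β α′ β′ *_) ∘ ih)) ⟩
    incidence β α + Σs (λ α′ → Σs (λ β′ →
      if stepGuard β α′ β′ then stepWeight β α′ β′ * (e β′ γ * incidence β′ α) else 0ℤ))
      ≡⟨ cong (incidence β α +_) (sift-steps v β (λ β′ → incidence β′ α)) ⟩
    incidence β α + lastStep β α γ
      ≡⟨ last-step-cancels v β ⟩
    e β γ * incidence β α ∎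
    where
    open ≡-Reasoning
    ih : ∀ {α′ β′} → stepGuard β α′ β′ ≡ true → ∂ (trajSum V N β′) α ≡ e β′ γ * incidence β′ α
    ih guard with stepGuard-sound guard
    ... | v′ , α′⊂β , β≢β′ = ∂trajSum-pairedUp v N _ (λ δ t → noTraj δ (step v′ α′⊂β β≢β′ t))

  critical-cases : ∀ {σ} → critical K V σ ≡ true →
    (∀ τ → V σ τ ≡ false × V τ σ ≡ false) ⊎ (∣ σ ∣ ≡ 1 × V ∅ σ ≡ true)
  critical-cases {σ} crit
    with ∨-true {all (λ τ → not (V σ τ) ∧ not (V τ σ)) (subsets n)}
                (proj₂ (∧-true {not ⌊ ∣ σ ∣ ℕ.≟ 0 ⌋} (proj₂ (∧-true {mem K σ} crit))))
  ... | inj₁ unpaired = inj₁ λ τ →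
    let both = ∧-true (all-true⁻ (subsets n) unpaired (subsets-complete τ))
    in  not-true (proj₁ both) , not-true (proj₂ both)
  ... | inj₂ vertex = inj₂ (⌊⌋-sound (∣ σ ∣ ℕ.≟ 1) (proj₁ (∧-true {⌊ ∣ σ ∣ ℕ.≟ 1 ⌋} vertex)) ,
                           proj₂ (∧-true {⌊ ∣ σ ∣ ℕ.≟ 1 ⌋} vertex))

  critical⇒¬pairedUp : ∀ {σ} → critical K V σ ≡ true → ¬ PairedUp σ
  critical⇒¬pairedUp crit (τ , v) with critical-cases crit
  ... | inj₁ unpaired with () ← trans (sym v) (proj₁ (unpaired τ))
  ... | inj₂ (_ , v∅) = pairedUp⇒¬pairedDown (τ , v) (∅ , v∅)

  critical-pairedDown⇒∅ : ∀ {σ} → critical K V σ ≡ true → PairedDown σ → V ∅ σ ≡ true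
  critical-pairedDown⇒∅ crit (α , v) with critical-cases crit
  ... | inj₁ unpaired with () ← trans (sym v) (proj₂ (unpaired α))
  ... | inj₂ (_ , v∅) = v∅

  Admissible : ℕ → Key n → Set
  Admissible q (C , σ) = (simplexᵇ K q σ ∧ critical K V σ) ≡ true
  Admissible q (U , α) = inUᵇ K V q α ≡ true
  Admissible q (D , β) = inDᵇ K V q β ≡ true

  admissible-C⇒critical : ∀ {q σ} → Admissible q (C , σ) → critical K V σ ≡ true
  admissible-C⇒critical {q} {σ} adm = proj₂ (∧-true {simplexᵇ K q σ} adm)

  -- only vertices are paired with ∅
  admissible-C⇒unpaired : ∀ {p σ} → Admissible (suc p) (C , σ) → ¬ PairedDown σ
  admissible-C⇒unpaired {p} {σ} adm (α , v) with critical-cases (admissible-C⇒critical adm)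
  ... | inj₁ unpaired with () ← trans (sym v) (proj₂ (unpaired α))
  ... | inj₂ (size , _) = ℕₚ.0≢1+n (ℕₚ.suc-injective (trans (sym size)
        (⌊⌋-sound (∣ σ ∣ ℕ.≟ suc (suc p))
                  (proj₂ (∧-true {mem K σ} (proj₁ (∧-true {simplexᵇ K (suc p) σ} adm)))))))

  admissible-U⇒pairedUp : ∀ {q α} → Admissible q (U , α) → PairedUp α
  admissible-U⇒pairedUp {q} {α} adm = any-true⁻ (subsets n) (proj₂ (∧-true {simplexᵇ K q α} adm))

  admissible-D⇒pairedDown : ∀ {q β} → Admissible q (D , β) → PairedDown β
  admissible-D⇒pairedDown {q} {β} adm = any-true⁻ (subsets n)
    (proj₂ (∧-true {not (critical K V β)} (proj₂ (∧-true {simplexᵇ K q β} adm))))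

  admissible-D⇒¬critical : ∀ {q β} → Admissible q (D , β) → critical K V β ≡ false
  admissible-D⇒¬critical {q} {β} adm =
    not-true (proj₁ (∧-true {not (critical K V β)} (proj₂ (∧-true {simplexᵇ K q β} adm))))

  InD⇒admissible : ∀ {q β} → InD K V q β → Admissible q (D , β)
  InD⇒admissible {q} {β} ((β∈K , size) , noncritical , (α , v)) =
    ∧-intro (∧-intro β∈K (⌊⌋-complete (∣ β ∣ ℕ.≟ suc q) size))
            (∧-intro (cong not noncritical) (any-true⁺ (subsets-complete α) v))

  facet-admissible : ∀ {p α β} → Simplex K (suc p) β → V α β ≡ true → Admissible p (U , α)
  facet-admissible {p} {α} {β} (_ , size) v =
    ∧-intro (∧-intro (proj₁ (inK α β v))
                     (⌊⌋-complete (∣ α ∣ ℕ.≟ suc p)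
                                  (ℕₚ.suc-injective (trans (proj₂ (facet α β v)) size))))
            (any-true⁺ (subsets-complete β) v)

  C-simplices U-simplices D-simplices : ℕ → List (Subset n)
  C-simplices q = filterᵇ (λ σ → simplexᵇ K q σ ∧ critical K V σ) (subsets n)
  U-simplices q = filterᵇ (inUᵇ K V q) (subsets n)
  D-simplices q = filterᵇ (inDᵇ K V q) (subsets n)

  keys : ℕ → List (Key n)
  keys q = map (C ,_) (C-simplices q) ++ (map (U ,_) (U-simplices q) ++ map (D ,_) (D-simplices q))

  basisChain : Key n → Chain n
  basisChain (C , σ) = arrow V σ
  basisChain (U , α) = ∂ (e (partner α))
  basisChain (D , β) = e β

  open Coordinates basisChain public

  filtered-unique : ∀ (f : Subset n → Bool) → Unique (filterᵇ f (subsets n))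
  filtered-unique f = Unique.filter⁺ (T? ∘ f) (subsets-unique n)

  partners : ∀ {α} → PairedUp α → filterᵇ (V α) (subsets n) ≡ partner α ∷ []
  partners {α} up = unique-constant (filtered-unique (V α))
                                (∈-filterᵇ⁺ (subsets-complete _) (partner-pairs up))
                                (λ β∈ → sym (partner-spec (∈-filterᵇ⁻ (subsets n) β∈)))

  basis≡ : ∀ q → basis K V q ≡ map basisChain (keys q)
  basis≡ q = begin
    basis K V q
      ≡⟨ cong₂ _++_ (map-∘ (C-simplices q)) (cong₂ _++_ U-part (map-∘ (D-simplices q))) ⟩
    map basisChain (map (C ,_) (C-simplices q))
      ++ (map basisChain (map (U ,_) (U-simplices q)) ++ map basisChain (map (D ,_) (D-simplices q)))
      ≡⟨ sym (trans (map-++ basisChain (map (C ,_) (C-simplices q)) _)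
                    (cong (map basisChain (map (C ,_) (C-simplices q)) ++_)
                          (map-++ basisChain (map (U ,_) (U-simplices q)) _))) ⟩
    map basisChain (keys q) ∎
    where
    open ≡-Reasoning
    U-part : concatMap (λ α → map (λ β → ∂ (e β)) (filterᵇ (V α) (subsets n))) (U-simplices q)
             ≡ map basisChain (map (U ,_) (U-simplices q))
    U-part = trans (concatMap-singletons (U-simplices q) λ α∈ →
                      cong (map (λ β → ∂ (e β)))
                           (partners (admissible-U⇒pairedUp (∈-filterᵇ⁻ (subsets n) α∈))))
                   (map-∘ (U-simplices q))

  keys-unique : ∀ q → Unique (keys q)
  keys-unique q = Unique.++⁺ (labelled-unique (filtered-unique (λ σ → simplexᵇ K q σ ∧ critical K V σ)))
    (Unique.++⁺ (labelled-unique (filtered-unique (inUᵇ K V q)))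
                (labelled-unique (filtered-unique (inDᵇ K V q)))
                (labels-disjoint λ ()))
    C-apart
    where
    C-apart : Disjoint (map (C ,_) (C-simplices q))
                       (map (U ,_) (U-simplices q) ++ map (D ,_) (D-simplices q))
    C-apart (k∈C , k∈UD) with ∈-++⁻ (map (U ,_) (U-simplices q)) k∈UD
    ... | inj₁ k∈U = labels-disjoint (λ ()) (k∈C , k∈U)
    ... | inj₂ k∈D = labels-disjoint (λ ()) (k∈C , k∈D)

  keys-admissible : ∀ q {k} → k ∈ keys q → Admissible q k
  keys-admissible q k∈ with ∈-++⁻ (map (C ,_) (C-simplices q)) k∈
  ... | inj₁ k∈C with ∈-map⁻ (C ,_) k∈C
  ...   | _ , σ∈ , refl = ∈-filterᵇ⁻ (subsets n) σ∈
  keys-admissible q k∈ | inj₂ k∈UD with ∈-++⁻ (map (U ,_) (U-simplices q)) k∈UD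
  ... | inj₁ k∈U with ∈-map⁻ (U ,_) k∈U
  ...   | _ , α∈ , refl = ∈-filterᵇ⁻ (subsets n) α∈
  keys-admissible q k∈ | inj₂ _ | inj₂ k∈D with ∈-map⁻ (D ,_) k∈D
  ...   | _ , β∈ , refl = ∈-filterᵇ⁻ (subsets n) β∈

  combination : (Key n → ℤ) → Chain n
  combination κ τ = ΣK (λ k → κ k * basisChain k τ)

  Supported : ℕ → (Key n → ℤ) → Set
  Supported q κ = ∀ k → κ k ≢ 0ℤ → Admissible q k

  coef-supported : ∀ q x → Supported q (coef (keys q) x)
  coef-supported q x k coef≢0 = keys-admissible q (coef-support (keys q) x k coef≢0)

  δ-supported : ∀ {q k} → Admissible q k → Supported q (δ k)
  δ-supported adm k′ δ≢0 = subst (Admissible _) (δ-nonzero δ≢0) adm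

  coordinates⇒combination : ∀ {q c x} → IsCoords (map basisChain (keys q)) c x →
                            ∀ τ → c τ ≡ combination (coef (keys q) x) τ
  coordinates⇒combination {q} {x = x} coords τ = trans (coords τ) (lookup-combination (keys q) x τ)

  basisChain≡combination-δ : ∀ k τ → basisChain k τ ≡ combination (δ k) τ
  basisChain≡combination-δ k τ = sym (ΣK-δˡ (λ k′ → basisChain k′ τ) k)

  combination-sub : ∀ κ κ′ τ →
    combination (λ k → κ k - κ′ k) τ ≡ combination κ τ - combination κ′ τ
  combination-sub κ κ′ τ =
    trans (ΣK-cong (λ k → *-distribʳ-sub (κ k) (κ′ k) (basisChain k τ)))
          (ΣK-sub (λ k → κ k * basisChain k τ) (λ k → κ′ k * basisChain k τ))

  combination-eval : ∀ κ τ → combination κ τ ≡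
    Σs (λ σ → κ (C , σ) * arrow V σ τ) + (Σs (λ α → κ (U , α) * incidence (partner α) τ) + κ (D , τ))
  combination-eval κ τ = cong (Σs (λ σ → κ (C , σ) * arrow V σ τ) +_) (cong₂ _+_
    (Σs-cong (λ α → cong (κ (U , α) *_) (∂-e (partner α) τ)))
    (Σs-eʳ τ (λ β → κ (D , β))))

  ∂-combination : ∀ κ τ → ∂ (combination κ) τ ≡ ΣK (λ k → κ k * ∂ (basisChain k) τ)
  ∂-combination κ τ =
    trans (∂-+ (part C) (λ σ → part U σ + part D σ) τ)
          (cong₂ _+_ (∂-part C) (trans (∂-+ (part U) (part D) τ) (cong₂ _+_ (∂-part U) (∂-part D))))
    where
    part : Part → Chain n
    part p τ = Σs (λ σ → κ (p , σ) * basisChain (p , σ) τ)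
    ∂-part : ∀ p → ∂ (part p) τ ≡ Σs (λ σ → κ (p , σ) * ∂ (basisChain (p , σ)) τ)
    ∂-part p = ∂-Σs-*ˡ (λ σ → κ (p , σ)) (λ σ → basisChain (p , σ)) τ

  arrow-unpaired : ∀ σ {τ} → ¬ PairedDown τ → arrow V σ τ ≡ e σ τ
  arrow-unpaired σ = trajSum-unpaired (2 ^ n) σ

  combination-at-pairedUp : ∀ {q κ} → Supported q κ → ∀ {α} → PairedUp α →
    combination κ α ≡ Σs (λ α′ → κ (U , α′) * incidence (partner α′) α)
  combination-at-pairedUp {κ = κ} supp {α} up =
    trans (combination-eval κ α)
          (trans (cong₂ _+_ arrows≡0 (cong (boundaries +_) D≡0))
                 (trans (ℤₚ.+-identityˡ (boundaries + 0ℤ)) (ℤₚ.+-identityʳ boundaries)))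
    where
    boundaries : ℤ
    boundaries = Σs (λ α′ → κ (U , α′) * incidence (partner α′) α)
    arrows≡0 : Σs (λ σ → κ (C , σ) * arrow V σ α) ≡ 0ℤ
    arrows≡0 = Σs-zero λ σ → *≡0 {κ (C , σ)} λ κ≢0 arrow≢0 →
      critical⇒¬pairedUp (admissible-C⇒critical (supp (C , σ) κ≢0))
        (subst PairedUp (sym (e-nonzero (arrow≢0 ∘ trans (arrow-unpaired σ (pairedUp⇒¬pairedDown up)))))
               up)
    D≡0 : κ (D , α) ≡ 0ℤ
    D≡0 = ≡0-stable λ κ≢0 → pairedUp⇒¬pairedDown up (admissible-D⇒pairedDown (supp (D , α) κ≢0))

  pullback : (Subset n → ℤ) → Subset n → ℤ
  pullback h α = if V α (partner α) then h (partner α) else 0ℤ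

  pullback-pairs : ∀ {h α β} → V α β ≡ true → pullback h α ≡ h β
  pullback-pairs {h} {β = β} v = trans (guarded-true (partner-pairs (β , v))) (cong h (partner-spec v))

  pullback-support : ∀ {h} α → pullback h α ≢ 0ℤ → PairedUp α
  pullback-support {h} α ≢0 = partner α , guarded≢0 (V α (partner α)) ≢0

  Σs-pullback : ∀ (h : Subset n → ℤ) → (∀ τ → h τ ≢ 0ℤ → PairedDown τ) → ∀ (g : Subset n → ℤ) →
                Σs (λ τ → h τ * g τ) ≡ Σs (λ α → pullback h α * g (partner α))
  Σs-pullback h h-supp g =
    trans (Σs-cong λ τ → spread τ (pairedDown? τ))
          (trans (Σs-swap (λ τ α → if V α τ then h τ * g τ else 0ℤ))
                 (Σs-cong λ α → collapse α (V α (partner α)) refl))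
    where
    spread : ∀ τ → Dec (PairedDown τ) → h τ * g τ ≡ Σs (λ α → if V α τ then h τ * g τ else 0ℤ)
    spread τ (yes (α₀ , v)) = sym (trans
      (Σs-single α₀ λ α α≢α₀ → guarded≡0 (V α τ) λ v′ → ⊥-elim (α≢α₀ (V-injective v′ v)))
      (guarded-true v))
    spread τ (no unpaired) = trans
      (*≡0 {h τ} λ h≢0 _ → unpaired (h-supp τ h≢0))
      (sym (Σs-zero λ α → guarded≡0 (V α τ) λ v → ⊥-elim (unpaired (α , v))))
    collapse : ∀ α b → V α (partner α) ≡ b →
      Σs (λ τ → if V α τ then h τ * g τ else 0ℤ) ≡ (if b then h (partner α) else 0ℤ) * g (partner α)
    collapse α true  paired = trans
      (Σs-single (partner α) λ τ τ≢ → guarded≡0 (V α τ) λ v → ⊥-elim (τ≢ (sym (partner-spec v))))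
      (guarded-true paired)
    collapse α false unpaired = trans
      (Σs-zero λ τ → guarded≡0 (V α τ) λ v → case trans (sym (partner-pairs (τ , v))) unpaired of λ ())
      (sym (ℤₚ.*-zeroˡ (g (partner α))))

  module _ (grad : IsGradient V) where

    -- If d α′ ≠ 0 and [V α′, α] ≠ 0 with α′ ≠ α, every trajectory ending at
    -- V α′ extends to one ending at V α; so induction on the length bound of
    -- trajectories ending at V α works, the diagonal entries being ±1.
    pairedUp-triangular : (d : Subset n → ℤ) → (∀ α → d α ≢ 0ℤ → PairedUp α) →
      (∀ α → PairedUp α → Σs (λ α′ → d α′ * incidence (partner α′) α) ≡ 0ℤ) →
      ∀ α → d α ≡ 0ℤ
    pairedUp-triangular d d-supp d-kernel α = vanish (2 ^ n) α (λ δ → ¬Traj-2^n grad)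
      where
      vanish : ∀ N α → (∀ δ → ¬ Traj V δ (partner α) N) → d α ≡ 0ℤ
      vanish zero    α noTraj = ⊥-elim (noTraj _ (stop _))
      vanish (suc N) α noTraj with d α ℤ.≟ 0ℤ
      ... | yes dα≡0 = dα≡0
      ... | no dα≢0  = *-unit-cancel (incidence²≡1 (partner α) α (partner-facet up))
                                     (trans (sym (Σs-single α others)) (d-kernel α up))
        where
        up : PairedUp α
        up = d-supp α dα≢0
        others : ∀ α′ → α′ ≢ α → d α′ * incidence (partner α′) α ≡ 0ℤ
        others α′ α′≢α = *≡0 {d α′} {incidence (partner α′) α} λ dα′≢0 inc≢0 →
          dα′≢0 (vanish N α′ λ δ t → noTraj δ
            (Traj-snoc t (partner-pairs up) (incidence≢0⇒facet _ _ inc≢0)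
                       (α′≢α ∘ partner-injective (d-supp α′ dα′≢0) up)))

    ∂arrow-pairedUp : ∀ {α γ} → V α γ ≡ true → ∀ σ → ∂ (arrow V σ) α ≡ e σ γ * incidence σ α
    ∂arrow-pairedUp v σ = ∂trajSum-pairedUp v (2 ^ n) σ (λ _ → ¬Traj-2^n grad)

    ∂combination-at-pairedUp : ∀ {p κ} → Supported (suc p) κ → ∀ {α} → PairedUp α →
      ∂ (combination κ) α ≡ Σs (λ β → κ (D , β) * incidence β α)
    ∂combination-at-pairedUp {κ = κ} supp {α} up =
      trans (∂-combination κ α)
            (trans (cong₂ _+_ arrows≡0
                              (cong₂ _+_ boundaries≡0 (Σs-cong λ β → cong (κ (D , β) *_) (∂-e β α))))
                   (trans (ℤₚ.+-identityˡ _) (ℤₚ.+-identityˡ _)))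
      where
      arrows≡0 : Σs (λ σ → κ (C , σ) * ∂ (arrow V σ) α) ≡ 0ℤ
      arrows≡0 = Σs-zero λ σ → trans
        (*-cong-≢0 (κ (C , σ)) λ κ≢0 → trans (∂arrow-pairedUp (partner-pairs up) σ)
          (trans (cong (_* incidence σ α)
                       (e-off {β = σ} {τ = partner α} λ { refl →
                          admissible-C⇒unpaired (supp (C , σ) κ≢0) (α , partner-pairs up) }))
                 (ℤₚ.*-zeroˡ (incidence σ α))))
        (ℤₚ.*-zeroʳ (κ (C , σ)))
      boundaries≡0 : Σs (λ α′ → κ (U , α′) * ∂ (∂ (e (partner α′))) α) ≡ 0ℤ
      boundaries≡0 = Σs-zero λ α′ → trans (cong (κ (U , α′) *_) (∂∂e≡0 (partner α′) α))
                                          (ℤₚ.*-zeroʳ (κ (U , α′)))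

    pairedUp-unique : ∀ (d d′ : Subset n → ℤ) →
      (∀ α → d α ≢ 0ℤ → PairedUp α) → (∀ α → d′ α ≢ 0ℤ → PairedUp α) →
      (∀ α → PairedUp α → Σs (λ α′ → d α′ * incidence (partner α′) α)
                        ≡ Σs (λ α′ → d′ α′ * incidence (partner α′) α)) →
      ∀ α → d α ≡ d′ α
    pairedUp-unique d d′ d-supp d′-supp same α = ℤₚ.i-j≡0⇒i≡j (d α) (d′ α)
      (pairedUp-triangular (λ α → d α - d′ α) (sub-support d-supp d′-supp)
        (λ α up → trans (Σs-cong λ α′ → *-distribʳ-sub (d α′) (d′ α′) (incidence (partner α′) α))
                 (trans (Σs-sub (λ α′ → d α′ * incidence (partner α′) α)
                                (λ α′ → d′ α′ * incidence (partner α′) α))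
                 (trans (cong (_- Σs (λ α′ → d′ α′ * incidence (partner α′) α)) (same α up))
                        (ℤₚ.+-inverseʳ (Σs (λ α′ → d′ α′ * incidence (partner α′) α))))))
        α)

    module _ {q : ℕ} {κ : Key n → ℤ} (supp : Supported q κ) (null : ∀ τ → combination κ τ ≡ 0ℤ) where

      private
        U≡0 : ∀ α → κ (U , α) ≡ 0ℤ
        U≡0 = pairedUp-triangular (λ α → κ (U , α))
          (λ α κ≢0 → admissible-U⇒pairedUp (supp (U , α) κ≢0))
          (λ α up → trans (sym (combination-at-pairedUp supp up)) (null α))

        boundaries≡0 : ∀ τ → Σs (λ α → κ (U , α) * incidence (partner α) τ) ≡ 0ℤ
        boundaries≡0 τ = Σs-zero λ α → trans (cong (_* incidence (partner α) τ) (U≡0 α))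
                                              (ℤₚ.*-zeroˡ (incidence (partner α) τ))

        combination-at-critical : ∀ σ′ → critical K V σ′ ≡ true →
          combination κ σ′ ≡ Σs (λ σ → κ (C , σ) * arrow V σ σ′)
        combination-at-critical σ′ crit =
          trans (combination-eval κ σ′)
                (trans (cong (arrows +_) (cong₂ _+_ (boundaries≡0 σ′) D≡0)) (ℤₚ.+-identityʳ arrows))
          where
          arrows : ℤ
          arrows = Σs (λ σ → κ (C , σ) * arrow V σ σ′)
          D≡0 : κ (D , σ′) ≡ 0ℤ
          D≡0 = ≡0-stable λ κ≢0 →
            case trans (sym crit) (admissible-D⇒¬critical (supp (D , σ′) κ≢0)) of λ ()

        C≡0-if-arrows-trivial : ∀ σ′ → (∀ σ → κ (C , σ) * arrow V σ σ′ ≡ κ (C , σ) * e σ σ′) →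
                                κ (C , σ′) ≡ 0ℤ
        C≡0-if-arrows-trivial σ′ trivial = ≡0-stable λ κ≢0 → κ≢0 (begin
          κ (C , σ′)                           ≡⟨ sym (Σs-eʳ σ′ (λ σ → κ (C , σ))) ⟩
          Σs (λ σ → κ (C , σ) * e σ σ′)        ≡⟨ sym (Σs-cong trivial) ⟩
          Σs (λ σ → κ (C , σ) * arrow V σ σ′)  ≡⟨ sym (combination-at-critical σ′
                                                    (admissible-C⇒critical (supp (C , σ′) κ≢0))) ⟩
          combination κ σ′                     ≡⟨ null σ′ ⟩
          0ℤ                                   ∎)
          where open ≡-Reasoning

        C≡0-unpaired : ∀ σ′ → ¬ PairedDown σ′ → κ (C , σ′) ≡ 0ℤ
        C≡0-unpaired σ′ unpaired =
          C≡0-if-arrows-trivial σ′ λ σ → cong (κ (C , σ) *_) (arrow-unpaired σ unpaired)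

        -- critical vertices paired with ∅ have trivial arrows; the other
        -- critical simplices have vanishing coefficients by C≡0-unpaired
        C≡0 : ∀ σ′ → κ (C , σ′) ≡ 0ℤ
        C≡0 σ′ = C≡0-if-arrows-trivial σ′ λ σ → *-cong-≢0 (κ (C , σ)) λ κ≢0 →
          arrow-trivial σ κ≢0 (pairedDown? σ)
          where
          arrow-trivial : ∀ σ → κ (C , σ) ≢ 0ℤ → Dec (PairedDown σ) → arrow V σ σ′ ≡ e σ σ′
          arrow-trivial σ κ≢0 (yes paired) = trajSum-from-∅
            (critical-pairedDown⇒∅ (admissible-C⇒critical (supp (C , σ) κ≢0)) paired) (2 ^ n) σ′
          arrow-trivial σ κ≢0 (no unpaired) = ⊥-elim (κ≢0 (C≡0-unpaired σ unpaired))

        D≡0 : ∀ β → κ (D , β) ≡ 0ℤ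
        D≡0 β = trans (sym at-β) (null β)
          where
          at-β : combination κ β ≡ κ (D , β)
          at-β = trans (combination-eval κ β)
            (trans (cong₂ _+_ (Σs-zero λ σ → trans (cong (_* arrow V σ β) (C≡0 σ)) (ℤₚ.*-zeroˡ (arrow V σ β)))
                              (cong (_+ κ (D , β)) (boundaries≡0 β)))
                   (trans (ℤₚ.+-identityˡ _) (ℤₚ.+-identityˡ _)))

      combination≡0⇒0 : ∀ k → κ k ≡ 0ℤ
      combination≡0⇒0 (C , σ) = C≡0 σ
      combination≡0⇒0 (U , α) = U≡0 α
      combination≡0⇒0 (D , β) = D≡0 β

    combination-injective : ∀ {q κ κ′} → Supported q κ → Supported q κ′ →
      (∀ τ → combination κ τ ≡ combination κ′ τ) → ∀ k → κ k ≡ κ′ k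
    combination-injective {κ = κ} {κ′} supp supp′ same k = ℤₚ.i-j≡0⇒i≡j (κ k) (κ′ k)
      (combination≡0⇒0 (sub-support supp supp′)
        (λ τ → trans (combination-sub κ κ′ τ)
                     (trans (cong (_- combination κ′ τ) (same τ)) (ℤₚ.+-inverseʳ (combination κ′ τ))))
        k)

    boundary-coefficients : ∀ {p κ κ′} → Supported (suc p) κ → Supported p κ′ →
      (∀ α → PairedUp α → ∂ (combination κ) α ≡ combination κ′ α) →
      ∀ {α β} → V α β ≡ true → κ′ (U , α) ≡ κ (D , β)
    boundary-coefficients {κ = κ} {κ′} supp supp′ ∂κ≡κ′ {α} v =
      trans (pairedUp-unique (λ α → κ′ (U , α)) (pullback κD)
               (λ α κ′≢0 → admissible-U⇒pairedUp (supp′ (U , α) κ′≢0)) (pullback-support {κD}) same α)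
            (pullback-pairs v)
      where
      κD : Subset n → ℤ
      κD β = κ (D , β)
      same : ∀ α → PairedUp α → Σs (λ α′ → κ′ (U , α′) * incidence (partner α′) α)
                              ≡ Σs (λ α′ → pullback κD α′ * incidence (partner α′) α)
      same α up = begin
        Σs (λ α′ → κ′ (U , α′) * incidence (partner α′) α) ≡⟨ sym (combination-at-pairedUp supp′ up) ⟩
        combination κ′ α                                    ≡⟨ sym (∂κ≡κ′ α up) ⟩
        ∂ (combination κ) α                                 ≡⟨ ∂combination-at-pairedUp supp up ⟩
        Σs (λ β → κD β * incidence β α)
          ≡⟨ Σs-pullback κD (λ β κ≢0 → admissible-D⇒pairedDown (supp (D , β) κ≢0))
                            (λ β → incidence β α) ⟩
        Σs (λ α′ → pullback κD α′ * incidence (partner α′) α) ∎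
        where open ≡-Reasoning

    dot-basisVector : ∀ {q k} → Admissible q k → (y x : Fin (length (map basisChain (keys q))) → ℤ) →
      IsCoords (map basisChain (keys q)) (basisChain k) x → dot y x ≡ coef (keys q) y k
    dot-basisVector {q} {k} adm y x coords = begin
      dot y x                                             ≡⟨ dot-coef (keys q) (keys-unique q) y x ⟩
      ΣK (λ k′ → coef (keys q) y k′ * coef (keys q) x k′)
        ≡⟨ ΣK-cong (λ k′ → cong (coef (keys q) y k′ *_) (x≡δ k′)) ⟩
      ΣK (λ k′ → coef (keys q) y k′ * δ k k′)             ≡⟨ ΣK-δʳ (coef (keys q) y) k ⟩
      coef (keys q) y k                                   ∎
      where
      open ≡-Reasoning
      x≡δ : ∀ k′ → coef (keys q) x k′ ≡ δ k k′
      x≡δ = combination-injective (coef-supported q x) (δ-supported adm)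
              (λ τ → trans (sym (coordinates⇒combination coords τ)) (basisChain≡combination-δ k τ))

    chain-map-pairing : ∀ (φ : ℕ → Subset n → Chain n) → IsChainMap K φ → ∀ p β → InD K V (suc p) β →
      (s₁ s₂ : Fin (length (map basisChain (keys (suc p)))) → ℤ) →
      (t₁ t₂ : Fin (length (map basisChain (keys p))) → ℤ) →
      IsCoords (map basisChain (keys (suc p))) (apply φ (suc p) (e β)) s₁ →
      IsCoords (map basisChain (keys (suc p))) (e β) s₂ →
      IsCoords (map basisChain (keys p)) (apply φ p (∂ (e β))) t₁ →
      IsCoords (map basisChain (keys p)) (∂ (e β)) t₂ →
      dot s₁ s₂ ≡ dot t₁ t₂
    chain-map-pairing φ φ-chain p β β∈D@(β∈K , _ , α₀ , α₀↦β) s₁ s₂ t₁ t₂ φβ≈s₁ β≈s₂ φ∂β≈t₁ ∂β≈t₂ = begin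
      dot s₁ s₂                      ≡⟨ dot-basisVector (InD⇒admissible β∈D) s₁ s₂ β≈s₂ ⟩
      coef (keys (suc p)) s₁ (D , β) ≡⟨ sym (boundary-coefficients (coef-supported (suc p) s₁)
                                              (coef-supported p t₁) ∂φβ≡φ∂β α₀↦β) ⟩
      coef (keys p) t₁ (U , α₀)      ≡⟨ sym (dot-basisVector (facet-admissible β∈K α₀↦β) t₁ t₂ ∂Vα₀≈t₂) ⟩
      dot t₁ t₂                      ∎
      where
      open ≡-Reasoning
      ∂Vα₀≈t₂ : IsCoords (map basisChain (keys p)) (basisChain (U , α₀)) t₂
      ∂Vα₀≈t₂ = subst (λ γ → IsCoords (map basisChain (keys p)) (∂ (e γ)) t₂)
                      (sym (partner-spec α₀↦β)) ∂β≈t₂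
      eβ∈C : IsChainOf K (suc p) (e β)
      eβ∈C σ eβσ≢0 = subst (Simplex K (suc p)) (e-nonzero eβσ≢0) β∈K
      ∂φβ≡φ∂β : ∀ α → PairedUp α →
                ∂ (combination (coef (keys (suc p)) s₁)) α ≡ combination (coef (keys p) t₁) α
      ∂φβ≡φ∂β α _ = begin
        ∂ (combination (coef (keys (suc p)) s₁)) α ≡⟨ ∂-cong (sym ∘ coordinates⇒combination φβ≈s₁) α ⟩
        ∂ (apply φ (suc p) (e β)) α                 ≡⟨ IsChainMap.commute φ-chain p (e β) eβ∈C α ⟩
        apply φ p (∂ (e β)) α                       ≡⟨ coordinates⇒combination φ∂β≈t₁ α ⟩
        combination (coef (keys p) t₁) α            ∎

lemma3p5 : ∀ {n} (K : Complex n) (d : ℕ) → HasDim K d →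
           (V : Subset n → Subset n → Bool) → IsDVF K V → IsGradient V →
           (φ : ℕ → Subset n → Chain n) → IsChainMap K φ →
           ∀ p → suc p ≤ d → ∀ β → InD K V (suc p) β →
           (s₁ s₂ : Fin (length (basis K V (suc p))) → ℤ) →
           (t₁ t₂ : Fin (length (basis K V p)) → ℤ) →
           IsCoords (basis K V (suc p)) (apply φ (suc p) (e β)) s₁ →
           IsCoords (basis K V (suc p)) (e β) s₂ →
           IsCoords (basis K V p) (apply φ p (∂ (e β))) t₁ →
           IsCoords (basis K V p) (∂ (e β)) t₂ →
           dot s₁ s₂ ≡ dot t₁ t₂
lemma3p5 K _ _ V dvf grad φ φ-chain p _ β β∈D
  rewrite VectorField.basis≡ dvf (suc p) | VectorField.basis≡ dvf p =
  VectorField.chain-map-pairing dvf grad φ φ-chain p β β∈D
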